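{- Let $\mathbb{F}$ be a field of characteristic different from $2$ and let $c\in\mathbb{F}$. Suppose that all of the following hold: (1) $c\notin\{ -1,0,1,1/2,2\}$; (2) $c$ is not a root of any of $x^2+x+1$, $x^2+x-1$, $x^2-x+1$, $x^2-x-1$; (3) $c$ is not a root of $x^2-3x+1$; (4) if $\operatorname{char}(\mathbb{F})\ne3$, then $c\notin\{ -1/3,-3,2/3,3/2,1/3,3,4/3,3/4\}$; (5) $c$ is a root of neither $x^2-3x+3$ nor $3x^2-3x+1$; (6) $c$ is a root of neither $x^3+x^2-1$ nor $x^3-x-1$; (7) $c$ is not a root of $x^2+1$; (8) $c$ is a root of neither $x^2-2x+2$ nor $2x^2-2x+1$; (9) $c$ is a root of neither $x^3-x^2+2x-1$ nor $x^3-2x^2+x-1$; (10) $c$ is a root of neither $x^3-2x^2+3x-1$ nor $x^3-3x^2+2x-1$. Then the following list of polynomials in $\mathbb{F}[x]$ is square-free: $x$, $x-1$, $x-c$, $x-1-c$, $x+1-c$, $(1-c)x-c$, $(1+c)x-c$, $g_1(x,c)$, $g_2(x,c)$, $g_3(x,c)$, $g_4(x,c)$, $f_1(x,c)$, $f_2(x,c)$, $f_3(x,c)$, $f_4(x,c)$.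
   Context: Here $g_1(x,c)=x^2+c-2x$, $g_2(x,c)=c^2+x-2c$, $g_3(x,c)=x^2+c-2xc$, $g_4(x,c)=c^2+x-2xc$, $f_1(x,c)=x^2+c^2-xc-x$, $f_2(x,c)=c^2+x^2-xc-c$, $f_3(x,c)=c^2x+xc-x^2-c^2$, $f_4(x,c)=x^2c+xc-x^2-c^2$. A list of polynomials $p_1,\dots,p_k\in\mathbb{F}[x]$ is square-free if there is no sequence $1\le i_1<\dots<i_r\le k$ with $r\ge1$ such that the product $p_{i_1}\cdots p_{i_r}$ is a square in $\bar{\mathbb{F}}[x]$, where $\bar{\mathbb{F}}$ is an algebraic closure of $\mathbb{F}$. -}

module Defs where

open import Level using (Level; _⊔_) renaming (suc to lsuc)
open import Algebra.Bundles using (CommutativeRing)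
open import Algebra.Morphism.Structures using (module RingMorphisms)
open import Data.Nat using (ℕ; zero; suc; _≥_)
open import Data.List using (List; []; _∷_; length; map)
open import Data.Bool using (Bool; true; false)
open import Data.Vec using (Vec; []; _∷_)
open import Data.Fin.Subset using (Subset; Nonempty)
open import Data.Product using (Σ; ∃; _×_; _,_)
open import Relation.Nullary using (¬_)

-- The inverse is a total operation
-- (its value at 0 is irrelevant), so that 1/2, -1/3, ... can be written.

record Field (c ℓ : Level) : Set (lsuc (c ⊔ ℓ)) where
  field
    commutativeRing : CommutativeRing c ℓ
  open CommutativeRing commutativeRing public
  infix 8 _⁻¹
  field
    _⁻¹      : Carrier → Carrier
    ⁻¹-cong  : ∀ {x y} → x ≈ y → x ⁻¹ ≈ y ⁻¹
    inverseʳ : ∀ x → ¬ (x ≈ 0#) → x * x ⁻¹ ≈ 1#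
    1≉0      : ¬ (1# ≈ 0#)

  infixl 7 _/_
  _/_ : Carrier → Carrier → Carrier
  x / y = x * y ⁻¹

  2# 3# 4# : Carrier
  2# = 1# + 1#
  3# = 2# + 1#
  4# = 3# + 1#

  CharNot2 : Set ℓ
  CharNot2 = ¬ (2# ≈ 0#)
  CharNot3 : Set ℓ
  CharNot3 = ¬ (3# ≈ 0#)

IsFieldHom : ∀ {c ℓ c' ℓ'} (F : Field c ℓ) (K : Field c' ℓ') →
             (Field.Carrier F → Field.Carrier K) → Set (c ⊔ ℓ ⊔ ℓ')
IsFieldHom F K ι =
  RingMorphisms.IsRingHomomorphism (Field.rawRing F) (Field.rawRing K) ι

-- Univariate polynomials over a field, as coefficient lists
-- (constant coefficient first); equality is coefficientwise, so
-- trailing zeros do not matter.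

module Poly {c ℓ} (F : Field c ℓ) where
  open Field F

  Pol : Set c
  Pol = List Carrier

  coeff : Pol → ℕ → Carrier
  coeff []      _       = 0#
  coeff (a ∷ p) zero    = a
  coeff (a ∷ p) (suc n) = coeff p n

  infix 4 _≈ₚ_
  _≈ₚ_ : Pol → Pol → Set ℓ
  p ≈ₚ q = ∀ n → coeff p n ≈ coeff q n

  infixl 6 _+ₚ_ _-ₚ_
  infixl 7 _*ₚ_
  _+ₚ_ : Pol → Pol → Pol
  []      +ₚ q       = q
  (a ∷ p) +ₚ []      = a ∷ p
  (a ∷ p) +ₚ (b ∷ q) = (a + b) ∷ (p +ₚ q)

  negₚ : Pol → Pol
  negₚ = map (-_)

  _-ₚ_ : Pol → Pol → Pol
  p -ₚ q = p +ₚ negₚ q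

  _*ₚ_ : Pol → Pol → Pol
  []      *ₚ q = []
  (a ∷ p) *ₚ q = map (a *_) q +ₚ (0# ∷ (p *ₚ q))

  C : Carrier → Pol
  C a = a ∷ []

  X : Pol
  X = 0# ∷ 1# ∷ []

  1ₚ : Pol
  1ₚ = C 1#

  eval : Pol → Carrier → Carrier
  eval []      _ = 0#
  eval (b ∷ p) a = b + a * eval p a

  IsRoot : Pol → Carrier → Set ℓ
  IsRoot p a = eval p a ≈ 0#

  NonConstant : Pol → Set ℓ
  NonConstant p = ∃ λ n → n ≥ 1 × ¬ (coeff p n ≈ 0#)

  IsSquare : Pol → Set (c ⊔ ℓ)
  IsSquare p = ∃ λ q → p ≈ₚ q *ₚ q

  selProd : (ps : List Pol) → Subset (length ps) → Pol
  selProd []       []           = 1ₚ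
  selProd (p ∷ ps) (true  ∷ s)  = p *ₚ selProd ps s
  selProd (p ∷ ps) (false ∷ s)  = selProd ps s

  -- square-free list in K[x] (K plays the role of the algebraic closure):
  -- no nonempty subsequence has a product which is a square in K[x]
  SquareFreeList : List Pol → Set (c ⊔ ℓ)
  SquareFreeList ps =
    ∀ (s : Subset (length ps)) → Nonempty s → ¬ IsSquare (selProd ps s)

AlgebraicallyClosed : ∀ {c ℓ} → Field c ℓ → Set (c ⊔ ℓ)
AlgebraicallyClosed K =
  ∀ p → NonConstant p → ∃ λ a → IsRoot p a
  where open Poly K

module TheList {c ℓ} (F : Field c ℓ) (c₀ : Field.Carrier F) where
  open Field F
  open Poly F

  g₁ g₂ g₃ g₄ f₁ f₂ f₃ f₄ : Pol
  g₁ = X *ₚ X +ₚ C c₀ -ₚ C 2# *ₚ X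
  g₂ = C (c₀ * c₀) +ₚ X -ₚ C (2# * c₀)
  g₃ = X *ₚ X +ₚ C c₀ -ₚ C 2# *ₚ X *ₚ C c₀
  g₄ = C (c₀ * c₀) +ₚ X -ₚ C 2# *ₚ X *ₚ C c₀
  f₁ = X *ₚ X +ₚ C (c₀ * c₀) -ₚ X *ₚ C c₀ -ₚ X
  f₂ = C (c₀ * c₀) +ₚ X *ₚ X -ₚ X *ₚ C c₀ -ₚ C c₀
  f₃ = C (c₀ * c₀) *ₚ X +ₚ X *ₚ C c₀ -ₚ X *ₚ X -ₚ C (c₀ * c₀)
  f₄ = X *ₚ X *ₚ C c₀ +ₚ X *ₚ C c₀ -ₚ X *ₚ X -ₚ C (c₀ * c₀)

  theList : List Pol
  theList =
      X
    ∷ X -ₚ 1ₚ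
    ∷ X -ₚ C c₀
    ∷ X -ₚ 1ₚ -ₚ C c₀
    ∷ X +ₚ 1ₚ -ₚ C c₀
    ∷ C (1# - c₀) *ₚ X -ₚ C c₀
    ∷ C (1# + c₀) *ₚ X -ₚ C c₀
    ∷ g₁ ∷ g₂ ∷ g₃ ∷ g₄ ∷ f₁ ∷ f₂ ∷ f₃ ∷ f₄ ∷ []

module Submission where

-- Every polynomial pᵢ of the list has a simple root αᵢ in K at which none of the later
-- polynomials pⱼ (j > i) vanishes.  For a nonempty selection with least index i, αᵢ is then
-- a simple root of the selected product, which is therefore not a square: every root of q²
-- is a root of (q²)′ = 2 q q′.  Both facts about αᵢ are certified by identities
-- u pᵢ + v pᵢ′ = N and u pᵢ + v pⱼ = N in ℤ[c, x], where N is a product of polynomials in c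
-- that conditions (1)-(10) keep nonzero; each identity is checked by ring normalisation.

open import Defs
open import Level using (_⊔_)
open import Agda.Builtin.FromNat using (Number)
open import Agda.Builtin.FromNeg using (Negative)
open import Algebra.Bundles using (CommutativeRing)
import Algebra.Morphism.Construct.Identity as Identity
open import Algebra.Morphism.Structures using (module RingMorphisms)
import Algebra.Solver.Ring
open import Algebra.Solver.Ring.AlmostCommutativeRing
  using (fromCommutativeRing; _-Raw-AlmostCommutative⟶_)
open import Data.Bool using (true; false)
import Data.Fin as Fin
open import Data.Fin using () renaming (zero to fzero; suc to fsuc)
open import Data.Integer as ℤ using (ℤ; +_; -[1+_])
import Data.Integer.Properties as ℤ
import Data.List as List
open import Data.List using (List; []; _∷_; map)
open import Data.List.NonEmpty as List⁺ using (List⁺; _∷_)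
open import Data.List.Relation.Unary.All as All using (All; []; _∷_)
import Data.List.Relation.Unary.All.Properties as All
open import Data.Maybe using (Maybe; just; nothing)
open import Data.Nat as ℕ using (ℕ; zero; suc; s≤s; z≤n)
import Data.Nat.Properties as ℕ
open import Data.Product using (∃; _×_; _,_; proj₁; proj₂)
open import Data.Sign as Sign using (Sign)
open import Data.Unit using (⊤)
open import Data.Vec using (Vec; []; _∷_; there)
open import Function using (_∘_)
open import Relation.Binary.PropositionalEquality as ≡ using (_≡_)
open import Relation.Nullary using (¬_; yes; no)

module IntegerCoefficients {c ℓ} (R : CommutativeRing c ℓ) where
  open CommutativeRing R
  open import Algebra.Properties.Semiring.Mult.TCOptimised semiring
    using (×-homo-+; ×1-homo-*) renaming (_×_ to _×′_)
  open import Algebra.Properties.Ring ring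
    using (-‿involutive; -0#≈0#; -‿distribˡ-*; -1*x≈-x)
  open import Algebra.Properties.AbelianGroup +-abelianGroup
    using (⁻¹-∙-comm)
  open import Algebra.Properties.CommutativeSemigroup +-commutativeSemigroup
    using () renaming (interchange to +-interchange)
  open import Algebra.Properties.CommutativeSemigroup *-commutativeSemigroup
    using () renaming (interchange to *-interchange)
  open import Relation.Binary.Reasoning.Setoid setoid

  -- With the optimised multiple, fromℕ 1, fromℕ 2, fromℕ 3, fromℕ 4 are definitionally
  -- 1#, 2#, 3#, 4#, so solver constants agree with the numerals of Field.
  fromℕ : ℕ → Carrier
  fromℕ n = n ×′ 1#

  fromℕ-suc : ∀ n → fromℕ (suc n) ≈ fromℕ n + 1#
  fromℕ-suc zero    = sym (+-identityˡ 1#)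
  fromℕ-suc (suc n) = refl

  fromℤ : ℤ → Carrier
  fromℤ (+ n)    = fromℕ n
  fromℤ -[1+ n ] = - fromℕ (suc n)

  fromℤ-⊖ : ∀ m n → fromℤ (m ℤ.⊖ n) ≈ fromℕ m - fromℕ n
  fromℤ-⊖ m zero rewrite ℤ.⊖-≥ (ℕ.z≤n {m}) = begin
    fromℕ m        ≈⟨ +-identityʳ (fromℕ m) ⟨
    fromℕ m + 0#   ≈⟨ +-congˡ -0#≈0# ⟨
    fromℕ m - 0#   ∎
  fromℤ-⊖ zero (suc n) rewrite ℤ.⊖-< (ℕ.z<s {n}) = sym (+-identityˡ _)
  fromℤ-⊖ (suc m) (suc n) rewrite ℤ.[1+m]⊖[1+n]≡m⊖n m n = begin
    fromℤ (m ℤ.⊖ n)                     ≈⟨ fromℤ-⊖ m n ⟩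
    fromℕ m - fromℕ n                   ≈⟨ cancel (fromℕ m) (fromℕ n) ⟨
    (fromℕ m + 1#) - (fromℕ n + 1#)     ≈⟨ +-cong (fromℕ-suc m) (-‿cong (fromℕ-suc n)) ⟨
    fromℕ (suc m) - fromℕ (suc n)       ∎
    where
    cancel : ∀ x y → (x + 1#) - (y + 1#) ≈ x - y
    cancel x y = begin
      (x + 1#) - (y + 1#)      ≈⟨ +-congˡ (⁻¹-∙-comm y 1#) ⟨
      (x + 1#) + (- y - 1#)    ≈⟨ +-interchange x 1# (- y) (- 1#) ⟩
      (x - y) + (1# - 1#)      ≈⟨ +-congˡ (-‿inverseʳ 1#) ⟩
      (x - y) + 0#             ≈⟨ +-identityʳ (x - y) ⟩
      x - y                    ∎

  fromℤ-+ : ∀ i j → fromℤ (i ℤ.+ j) ≈ fromℤ i + fromℤ j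
  fromℤ-+ (+ m)    (+ n)    = ×-homo-+ 1# m n
  fromℤ-+ (+ m)    -[1+ n ] = fromℤ-⊖ m (suc n)
  fromℤ-+ -[1+ m ] (+ n)    = trans (fromℤ-⊖ n (suc m)) (+-comm _ _)
  fromℤ-+ -[1+ m ] -[1+ n ] = begin
    - fromℕ (suc (suc (m ℕ.+ n)))     ≡⟨ ≡.cong (λ k → - fromℕ k) (ℕ.+-suc (suc m) n) ⟨
    - fromℕ (suc m ℕ.+ suc n)         ≈⟨ -‿cong (×-homo-+ 1# (suc m) (suc n)) ⟩
    - (fromℕ (suc m) + fromℕ (suc n)) ≈⟨ ⁻¹-∙-comm _ _ ⟨
    - fromℕ (suc m) - fromℕ (suc n)   ∎

  fromℤ-neg : ∀ i → fromℤ (ℤ.- i) ≈ - fromℤ i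
  fromℤ-neg (+ zero)  = sym -0#≈0#
  fromℤ-neg (+ suc n) = refl
  fromℤ-neg -[1+ n ]  = sym (-‿involutive _)

  fromSign : Sign → Carrier
  fromSign Sign.+ = 1#
  fromSign Sign.- = - 1#

  fromSign-* : ∀ s t → fromSign (s Sign.* t) ≈ fromSign s * fromSign t
  fromSign-* Sign.+ t      = sym (*-identityˡ _)
  fromSign-* Sign.- Sign.+ = sym (*-identityʳ _)
  fromSign-* Sign.- Sign.- = begin
    1#            ≈⟨ -‿involutive 1# ⟨
    - - 1#        ≈⟨ -1*x≈-x (- 1#) ⟨
    - 1# * - 1#   ∎

  fromℤ-◃ : ∀ s n → fromℤ (s ℤ.◃ n) ≈ fromSign s * fromℕ n
  fromℤ-◃ s      zero    = sym (zeroʳ _)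
  fromℤ-◃ Sign.+ (suc n) = sym (*-identityˡ _)
  fromℤ-◃ Sign.- (suc n) = sym (-1*x≈-x _)

  fromℤ-signAbs : ∀ i → fromℤ i ≈ fromSign (ℤ.sign i) * fromℕ ℤ.∣ i ∣
  fromℤ-signAbs (+ n)    = sym (*-identityˡ _)
  fromℤ-signAbs -[1+ n ] = sym (-1*x≈-x _)

  fromℤ-* : ∀ i j → fromℤ (i ℤ.* j) ≈ fromℤ i * fromℤ j
  fromℤ-* i j = begin
    fromℤ (i ℤ.* j)                                  ≈⟨ fromℤ-◃ (s Sign.* t) (m ℕ.* n) ⟩
    fromSign (s Sign.* t) * fromℕ (m ℕ.* n)          ≈⟨ *-cong (fromSign-* s t) (×1-homo-* m n) ⟩
    (fromSign s * fromSign t) * (fromℕ m * fromℕ n)  ≈⟨ *-interchange _ _ _ _ ⟩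
    (fromSign s * fromℕ m) * (fromSign t * fromℕ n)  ≈⟨ *-cong (fromℤ-signAbs i) (fromℤ-signAbs j) ⟨
    fromℤ i * fromℤ j                                ∎
    where
    s t : Sign
    s = ℤ.sign i
    t = ℤ.sign j
    m n : ℕ
    m = ℤ.∣ i ∣
    n = ℤ.∣ j ∣

  fromℤ-morphism : ℤ.+-*-rawRing -Raw-AlmostCommutative⟶ fromCommutativeRing R
  fromℤ-morphism = record
    { ⟦_⟧ = fromℤ ; +-homo = fromℤ-+ ; *-homo = fromℤ-* ; -‿homo = fromℤ-neg
    ; 0-homo = refl ; 1-homo = refl }

  fromℤ-equal? : ∀ i j → Maybe (fromℤ i ≈ fromℤ j)
  fromℤ-equal? i j with i ℤ.≟ j
  ... | yes ≡.refl = just refl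
  ... | no _       = nothing

  open Algebra.Solver.Ring ℤ.+-*-rawRing (fromCommutativeRing R) fromℤ-morphism fromℤ-equal?
    public

  instance
    literal : ∀ {n} → Number (Polynomial n)
    literal = record { Constraint = λ _ → ⊤ ; fromNat = λ k → con (+ k) }

    negativeLiteral : ∀ {n} → Negative (Polynomial n)
    negativeLiteral = record { Constraint = λ _ → ⊤ ; fromNeg = λ k → con (ℤ.- + k) }

module Evaluation {a ℓ a′ ℓ′} {F : Field a ℓ} {K : Field a′ ℓ′}
  {ι : Field.Carrier F → Field.Carrier K} (ι-hom : IsFieldHom F K ι) where
  open Poly F
  open Field K
  open RingMorphisms (Field.rawRing F) (Field.rawRing K)
  open IsRingHomomorphism ι-hom
  open IntegerCoefficients commutativeRing using (solve; _:=_; _:+_; _:*_; :-_; con)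
  open import Algebra.Properties.Ring ring using (-0#≈0#)
  open Field F using () renaming (_*_ to _F*_; 0# to F0; 1# to F1; _≈_ to _F≈_; sym to F-sym)
  open import Relation.Binary.Reasoning.Setoid setoid

  ev : Pol → Carrier → Carrier
  ev []      x = 0#
  ev (b ∷ p) x = ι b + x * ev p x

  -- The value at x of the formal derivative: (b + X q)′ = q + X q′.
  ev′ : Pol → Carrier → Carrier
  ev′ []      x = 0#
  ev′ (b ∷ p) x = ev p x + x * ev′ p x

  private
    step-+ : ∀ u v y s t → (u + v) + y * (s + t) ≈ (u + y * s) + (v + y * t)
    step-+ = solve 5 (λ u v y s t →
      (u :+ v) :+ y :* (s :+ t) := (u :+ y :* s) :+ (v :+ y :* t)) refl

    step-neg : ∀ u y s → - u + y * - s ≈ - (u + y * s)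
    step-neg = solve 3 (λ u y s → :- u :+ y :* (:- s) := :- (u :+ y :* s)) refl

    step-scale : ∀ k u y s → k * u + y * (k * s) ≈ k * (u + y * s)
    step-scale = solve 4 (λ k u y s → k :* u :+ y :* (k :* s) := k :* (u :+ y :* s)) refl

    step-* : ∀ u v y s → u * v + (0# + y * (s * v)) ≈ (u + y * s) * v
    step-* = solve 4 (λ u v y s →
      u :* v :+ (con (+ 0) :+ y :* (s :* v)) := (u :+ y :* s) :* v) refl

    step-′* : ∀ b w y s v t →
              b * w + (s * v + y * (t * v + s * w)) ≈ (s + y * t) * v + (b + y * s) * w
    step-′* = solve 6 (λ b w y s v t →
      b :* w :+ (s :* v :+ y :* (t :* v :+ s :* w)) := (s :+ y :* t) :* v :+ (b :+ y :* s) :* w) refl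

  ev-+ₚ : ∀ p q x → ev (p +ₚ q) x ≈ ev p x + ev q x
  ev-+ₚ []      q       x = sym (+-identityˡ _)
  ev-+ₚ (b ∷ p) []      x = sym (+-identityʳ _)
  ev-+ₚ (b ∷ p) (d ∷ q) x =
    trans (+-cong (+-homo b d) (*-congˡ (ev-+ₚ p q x))) (step-+ (ι b) (ι d) x (ev p x) (ev q x))

  ev′-+ₚ : ∀ p q x → ev′ (p +ₚ q) x ≈ ev′ p x + ev′ q x
  ev′-+ₚ []      q       x = sym (+-identityˡ _)
  ev′-+ₚ (b ∷ p) []      x = sym (+-identityʳ _)
  ev′-+ₚ (b ∷ p) (d ∷ q) x =
    trans (+-cong (ev-+ₚ p q x) (*-congˡ (ev′-+ₚ p q x)))
          (step-+ (ev p x) (ev q x) x (ev′ p x) (ev′ q x))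

  ev-negₚ : ∀ p x → ev (negₚ p) x ≈ - ev p x
  ev-negₚ []      x = sym -0#≈0#
  ev-negₚ (b ∷ p) x =
    trans (+-cong (-‿homo b) (*-congˡ (ev-negₚ p x))) (step-neg (ι b) x (ev p x))

  ev′-negₚ : ∀ p x → ev′ (negₚ p) x ≈ - ev′ p x
  ev′-negₚ []      x = sym -0#≈0#
  ev′-negₚ (b ∷ p) x =
    trans (+-cong (ev-negₚ p x) (*-congˡ (ev′-negₚ p x))) (step-neg (ev p x) x (ev′ p x))

  ev-scale : ∀ k p x → ev (List.map (k F*_) p) x ≈ ι k * ev p x
  ev-scale k []      x = sym (zeroʳ _)
  ev-scale k (b ∷ p) x =
    trans (+-cong (*-homo k b) (*-congˡ (ev-scale k p x))) (step-scale (ι k) (ι b) x (ev p x))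

  ev′-scale : ∀ k p x → ev′ (List.map (k F*_) p) x ≈ ι k * ev′ p x
  ev′-scale k []      x = sym (zeroʳ _)
  ev′-scale k (b ∷ p) x =
    trans (+-cong (ev-scale k p x) (*-congˡ (ev′-scale k p x)))
          (step-scale (ι k) (ev p x) x (ev′ p x))

  ev-*ₚ : ∀ p q x → ev (p *ₚ q) x ≈ ev p x * ev q x
  ev-*ₚ []      q x = sym (zeroˡ _)
  ev-*ₚ (b ∷ p) q x = begin
    ev (List.map (b F*_) q +ₚ (F0 ∷ p *ₚ q)) x
      ≈⟨ ev-+ₚ (List.map (b F*_) q) (F0 ∷ p *ₚ q) x ⟩
    ev (List.map (b F*_) q) x + (ι F0 + x * ev (p *ₚ q) x)
      ≈⟨ +-cong (ev-scale b q x) (+-cong 0#-homo (*-congˡ (ev-*ₚ p q x))) ⟩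
    ι b * ev q x + (0# + x * (ev p x * ev q x))
      ≈⟨ step-* (ι b) (ev q x) x (ev p x) ⟩
    (ι b + x * ev p x) * ev q x ∎

  ev′-*ₚ : ∀ p q x → ev′ (p *ₚ q) x ≈ ev′ p x * ev q x + ev p x * ev′ q x
  ev′-*ₚ []      q x = sym (trans (+-cong (zeroˡ _) (zeroˡ _)) (+-identityˡ 0#))
  ev′-*ₚ (b ∷ p) q x = begin
    ev′ (List.map (b F*_) q +ₚ (F0 ∷ p *ₚ q)) x
      ≈⟨ ev′-+ₚ (List.map (b F*_) q) (F0 ∷ p *ₚ q) x ⟩
    ev′ (List.map (b F*_) q) x + (ev (p *ₚ q) x + x * ev′ (p *ₚ q) x)
      ≈⟨ +-cong (ev′-scale b q x) (+-cong (ev-*ₚ p q x) (*-congˡ (ev′-*ₚ p q x))) ⟩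
    ι b * ev′ q x + (ev p x * ev q x + x * (ev′ p x * ev q x + ev p x * ev′ q x))
      ≈⟨ step-′* (ι b) (ev′ q x) x (ev p x) (ev q x) (ev′ p x) ⟩
    (ev p x + x * ev′ p x) * ev q x + (ι b + x * ev p x) * ev′ q x ∎

  ev-C : ∀ b x → ev (C b) x ≈ ι b
  ev-C b x = trans (+-congˡ (zeroʳ x)) (+-identityʳ (ι b))

  ev′-C : ∀ b x → ev′ (C b) x ≈ 0#
  ev′-C b x = trans (+-congˡ (zeroʳ x)) (+-identityʳ 0#)

  ev-X : ∀ x → ev X x ≈ x
  ev-X x = begin
    ι F0 + x * ev (C F1) x  ≈⟨ +-cong 0#-homo (*-congˡ (trans (ev-C F1 x) 1#-homo)) ⟩
    0# + x * 1#             ≈⟨ +-identityˡ (x * 1#) ⟩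
    x * 1#                  ≈⟨ *-identityʳ x ⟩
    x                       ∎

  ev′-X : ∀ x → ev′ X x ≈ 1#
  ev′-X x = begin
    ev (C F1) x + x * ev′ (C F1) x  ≈⟨ +-cong (trans (ev-C F1 x) 1#-homo) (*-congˡ (ev′-C F1 x)) ⟩
    1# + x * 0#                     ≈⟨ +-congˡ (zeroʳ x) ⟩
    1# + 0#                         ≈⟨ +-identityʳ 1# ⟩
    1#                              ∎

  private
    ι≈0 : ∀ {b} → b F≈ F0 → ι b ≈ 0#
    ι≈0 b≈0 = trans (⟦⟧-cong b≈0) 0#-homo

    vanishing : ∀ {u v} x → u ≈ 0# → v ≈ 0# → u + x * v ≈ 0#
    vanishing x u≈0 v≈0 = trans (+-cong u≈0 (trans (*-congˡ v≈0) (zeroʳ x))) (+-identityˡ 0#)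

  ev-resp-≈ₚ : ∀ p q x → p ≈ₚ q → ev p x ≈ ev q x × ev′ p x ≈ ev′ q x
  ev-resp-≈ₚ []      []      x p≈q = refl , refl
  ev-resp-≈ₚ []      (d ∷ q) x p≈q =
    let v , v′ = ev-resp-≈ₚ [] q x (λ n → p≈q (suc n))
    in sym (vanishing x (ι≈0 (F-sym (p≈q 0))) (sym v)) , sym (vanishing x (sym v) (sym v′))
  ev-resp-≈ₚ (b ∷ p) []      x p≈q =
    let v , v′ = ev-resp-≈ₚ p [] x (λ n → p≈q (suc n))
    in vanishing x (ι≈0 (p≈q 0)) v , vanishing x v v′
  ev-resp-≈ₚ (b ∷ p) (d ∷ q) x p≈q =
    let v , v′ = ev-resp-≈ₚ p q x (λ n → p≈q (suc n))
    in +-cong (⟦⟧-cong (p≈q 0)) (*-congˡ v) , +-cong v (*-congˡ v′)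

module FieldProperties {a ℓ} (F : Field a ℓ) where
  open Field F
  open import Relation.Binary.Reasoning.Setoid setoid

  *-cancelˡ-≈0 : ∀ {x y} → ¬ x ≈ 0# → x * y ≈ 0# → y ≈ 0#
  *-cancelˡ-≈0 {x} {y} x≉0 xy≈0 = begin
    y                  ≈⟨ *-identityˡ y ⟨
    1# * y             ≈⟨ *-congʳ (inverseʳ x x≉0) ⟨
    (x * x ⁻¹) * y     ≈⟨ *-congʳ (*-comm x (x ⁻¹)) ⟩
    (x ⁻¹ * x) * y     ≈⟨ *-assoc (x ⁻¹) x y ⟩
    x ⁻¹ * (x * y)     ≈⟨ *-congˡ xy≈0 ⟩
    x ⁻¹ * 0#          ≈⟨ zeroʳ (x ⁻¹) ⟩
    0#                 ∎

  *-≉0 : ∀ {x y} → ¬ x ≈ 0# → ¬ y ≈ 0# → ¬ x * y ≈ 0#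
  *-≉0 x≉0 y≉0 xy≈0 = y≉0 (*-cancelˡ-≈0 x≉0 xy≈0)

module ExcludedValues {a ℓ} (F : Field a ℓ) (c : Field.Carrier F) where
  open Field F
  open FieldProperties F using (*-≉0)
  open IntegerCoefficients commutativeRing
    using (Polynomial; solve; _:=_; _:+_; _:*_; _:-_; :-_; con)
  open import Algebra.Properties.Group +-group using (inverseˡ-unique; x∙y⁻¹≈ε⇒x≈y)
  open import Algebra.Properties.Ring ring using (-‿distribˡ-*)
  open import Relation.Binary.Reasoning.Setoid setoid

  private
    infix 10 #_
    #_ : ∀ {n} → ℕ → Polynomial n
    # k = con (+ k)

  a*x≈b⇒x≈b/a : ∀ {a x b} → ¬ a ≈ 0# → a * x ≈ b → x ≈ b / a
  a*x≈b⇒x≈b/a {a} {x} {b} a≉0 ax≈b = begin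
    x                  ≈⟨ *-identityˡ x ⟨
    1# * x             ≈⟨ *-congʳ (inverseʳ a a≉0) ⟨
    (a * a ⁻¹) * x     ≈⟨ *-congʳ (*-comm a (a ⁻¹)) ⟩
    (a ⁻¹ * a) * x     ≈⟨ *-assoc (a ⁻¹) a x ⟩
    a ⁻¹ * (a * x)     ≈⟨ *-congˡ ax≈b ⟩
    a ⁻¹ * b           ≈⟨ *-comm (a ⁻¹) b ⟩
    b / a              ∎

  c+b≉0 : ∀ {b} → ¬ c ≈ - b → ¬ c + b ≈ 0#
  c+b≉0 {b} c≉-b = c≉-b ∘ inverseˡ-unique c b

  c-b≉0 : ∀ {b} → ¬ c ≈ b → ¬ c - b ≈ 0#
  c-b≉0 {b} c≉b = c≉b ∘ x∙y⁻¹≈ε⇒x≈y c b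

  ac+b≉0 : ∀ {a b} → ¬ a ≈ 0# → ¬ c ≈ - (b / a) → ¬ a * c + b ≈ 0#
  ac+b≉0 {a} {b} a≉0 c≉-b/a ac+b≈0 = c≉-b/a (begin
    c              ≈⟨ a*x≈b⇒x≈b/a a≉0 (inverseˡ-unique (a * c) b ac+b≈0) ⟩
    - b * a ⁻¹     ≈⟨ -‿distribˡ-* b (a ⁻¹) ⟨
    - (b / a)      ∎)

  ac-b≉0 : ∀ {a b} → ¬ a ≈ 0# → ¬ c ≈ b / a → ¬ a * c - b ≈ 0#
  ac-b≉0 {a} {b} a≉0 c≉b/a = c≉b/a ∘ a*x≈b⇒x≈b/a a≉0 ∘ x∙y⁻¹≈ε⇒x≈y (a * c) b

  -- Condition (4) is only assumed away from characteristic 3, where v reduces to w.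
  split-char3 : ∀ {v w u} → v ≈ w + 3# * u → ¬ w ≈ 0# → (CharNot3 → ¬ v ≈ 0#) → ¬ v ≈ 0#
  split-char3 {v} {w} {u} v≈w+3u w≉0 v≉0 v≈0 = v≉0 3≉0 v≈0
    where
    3≉0 : CharNot3
    3≉0 3≈0 = w≉0 (begin
      w             ≈⟨ +-identityʳ w ⟨
      w + 0#        ≈⟨ +-congˡ (zeroˡ u) ⟨
      w + 0# * u    ≈⟨ +-congˡ (*-congʳ 3≈0) ⟨
      w + 3# * u    ≈⟨ v≈w+3u ⟨
      v             ≈⟨ v≈0 ⟩
      0#            ∎)

  4≉0 : CharNot2 → ¬ 4# ≈ 0#
  4≉0 2≉0 = *-≉0 2≉0 2≉0 ∘ trans (solve 0 (# 2 :* # 2 := # 4) refl)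

  3c+1≉0 : (CharNot3 → ¬ c ≈ - (1# / 3#)) → ¬ 3# * c + 1# ≈ 0#
  3c+1≉0 c≉-1/3 = split-char3
    (solve 1 (λ c → # 3 :* c :+ # 1 := # 1 :+ # 3 :* c) refl c)
    1≉0 (λ 3≉0 → ac+b≉0 3≉0 (c≉-1/3 3≉0))

  c+3≉0 : ¬ c ≈ 0# → (CharNot3 → ¬ c ≈ - 3#) → ¬ c + 3# ≈ 0#
  c+3≉0 c≉0 c≉-3 = split-char3
    (solve 1 (λ c → c :+ # 3 := c :+ # 3 :* # 1) refl c)
    c≉0 (λ 3≉0 → c+b≉0 (c≉-3 3≉0))

  3c-2≉0 : (CharNot3 → ¬ c ≈ 2# / 3#) → ¬ 3# * c - 2# ≈ 0#
  3c-2≉0 c≉2/3 = split-char3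
    (solve 1 (λ c → # 3 :* c :- # 2 := # 1 :+ # 3 :* (c :- # 1)) refl c)
    1≉0 (λ 3≉0 → ac-b≉0 3≉0 (c≉2/3 3≉0))

  2c-3≉0 : CharNot2 → ¬ c ≈ 0# → (CharNot3 → ¬ c ≈ 3# / 2#) → ¬ 2# * c - 3# ≈ 0#
  2c-3≉0 2≉0 c≉0 c≉3/2 = split-char3
    (solve 1 (λ c → # 2 :* c :- # 3 := # 2 :* c :+ # 3 :* (:- # 1)) refl c)
    (*-≉0 2≉0 c≉0) (λ 3≉0 → ac-b≉0 2≉0 (c≉3/2 3≉0))

  3c-1≉0 : CharNot2 → (CharNot3 → ¬ c ≈ 1# / 3#) → ¬ 3# * c - 1# ≈ 0#
  3c-1≉0 2≉0 c≉1/3 = split-char3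
    (solve 1 (λ c → # 3 :* c :- # 1 := # 2 :+ # 3 :* (c :- # 1)) refl c)
    2≉0 (λ 3≉0 → ac-b≉0 3≉0 (c≉1/3 3≉0))

  c-3≉0 : ¬ c ≈ 0# → (CharNot3 → ¬ c ≈ 3#) → ¬ c - 3# ≈ 0#
  c-3≉0 c≉0 c≉3 = split-char3
    (solve 1 (λ c → c :- # 3 := c :+ # 3 :* (:- # 1)) refl c)
    c≉0 (λ 3≉0 → c-b≉0 (c≉3 3≉0))

  3c-4≉0 : CharNot2 → (CharNot3 → ¬ c ≈ 4# / 3#) → ¬ 3# * c - 4# ≈ 0#
  3c-4≉0 2≉0 c≉4/3 = split-char3
    (solve 1 (λ c → # 3 :* c :- # 4 := # 2 :+ # 3 :* (c :- # 2)) refl c)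
    2≉0 (λ 3≉0 → ac-b≉0 3≉0 (c≉4/3 3≉0))

  4c-3≉0 : CharNot2 → ¬ c ≈ 0# → (CharNot3 → ¬ c ≈ 3# / 4#) → ¬ 4# * c - 3# ≈ 0#
  4c-3≉0 2≉0 c≉0 c≉3/4 = split-char3
    (solve 1 (λ c → # 4 :* c :- # 3 := c :+ # 3 :* (c :- # 1)) refl c)
    c≉0 (λ 3≉0 → ac-b≉0 (4≉0 2≉0) (c≉3/4 3≉0))

module SimpleRoots {a ℓ} (K : Field a ℓ) where
  open Field K
  open Poly K
  open FieldProperties K using (*-≉0)
  open Evaluation {F = K} {K = K} (Identity.isRingHomomorphism rawRing refl)
  open import Relation.Binary.Reasoning.Setoid setoid

  record SimpleRoot (p : Pol) (x : Carrier) : Set ℓ where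
    constructor simpleRoot
    field
      root   : ev p x ≈ 0#
      simple : ¬ ev′ p x ≈ 0#

  NonRoot : Carrier → Pol → Set ℓ
  NonRoot x q = ¬ ev q x ≈ 0#

  data FreshSimpleRoots : List Pol → Set (a ⊔ ℓ) where
    []  : FreshSimpleRoots []
    _∷_ : ∀ {p ps} → (∃ λ x → SimpleRoot p x × All (NonRoot x) ps) →
          FreshSimpleRoots ps → FreshSimpleRoots (p ∷ ps)

  square⇒¬SimpleRoot : ∀ {p x} → IsSquare p → ¬ SimpleRoot p x
  square⇒¬SimpleRoot {p} {x} (q , p≈q²) (simpleRoot p≈0 p′≉0) =
    *-≉0 q≉0 q≉0 (trans (sym (ev-*ₚ q q x)) (trans (sym p≈) p≈0))
    where
    p≈ : ev p x ≈ ev (q *ₚ q) x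
    p≈ = proj₁ (ev-resp-≈ₚ p (q *ₚ q) x p≈q²)
    p′≈ : ev′ p x ≈ ev′ (q *ₚ q) x
    p′≈ = proj₂ (ev-resp-≈ₚ p (q *ₚ q) x p≈q²)
    q≉0 : ¬ ev q x ≈ 0#
    q≉0 q≈0 = p′≉0 (begin
      ev′ p x                              ≈⟨ p′≈ ⟩
      ev′ (q *ₚ q) x                       ≈⟨ ev′-*ₚ q q x ⟩
      ev′ q x * ev q x + ev q x * ev′ q x  ≈⟨ +-cong (*-congˡ q≈0) (*-congʳ q≈0) ⟩
      ev′ q x * 0# + 0# * ev′ q x          ≈⟨ +-cong (zeroʳ _) (zeroˡ _) ⟩
      0# + 0#                              ≈⟨ +-identityˡ 0# ⟩
      0#                                   ∎)

  SimpleRoot-*ₚ : ∀ {p q x} → SimpleRoot p x → NonRoot x q → SimpleRoot (p *ₚ q) x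
  SimpleRoot-*ₚ {p} {q} {x} (simpleRoot p≈0 p′≉0) q≉0 = simpleRoot pq≈0 pq′≉0
    where
    p·q′≈0 : ev p x * ev′ q x ≈ 0#
    p·q′≈0 = trans (*-congʳ p≈0) (zeroˡ _)
    pq≈0 : ev (p *ₚ q) x ≈ 0#
    pq≈0 = trans (ev-*ₚ p q x) (trans (*-congʳ p≈0) (zeroˡ _))
    pq′≉0 : ¬ ev′ (p *ₚ q) x ≈ 0#
    pq′≉0 pq′≈0 = *-≉0 p′≉0 q≉0 (begin
      ev′ p x * ev q x                      ≈⟨ +-identityʳ _ ⟨
      ev′ p x * ev q x + 0#                 ≈⟨ +-congˡ p·q′≈0 ⟨
      ev′ p x * ev q x + ev p x * ev′ q x   ≈⟨ ev′-*ₚ p q x ⟨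
      ev′ (p *ₚ q) x                        ≈⟨ pq′≈0 ⟩
      0#                                    ∎)

  selProd-NonRoot : ∀ {x} ps → All (NonRoot x) ps → ∀ s → NonRoot x (selProd ps s)
  selProd-NonRoot {x} [] [] [] 1≈0 =
    1≉0 (trans (sym (trans (+-congˡ (zeroʳ x)) (+-identityʳ 1#))) 1≈0)
  selProd-NonRoot (p ∷ ps) (p≉0 ∷ ps≉0) (true ∷ s) =
    *-≉0 p≉0 (selProd-NonRoot ps ps≉0 s) ∘ trans (sym (ev-*ₚ p (selProd ps s) _))
  selProd-NonRoot (p ∷ ps) (p≉0 ∷ ps≉0) (false ∷ s) = selProd-NonRoot ps ps≉0 s

  squareFree : ∀ {ps} → FreshSimpleRoots ps → SquareFreeList ps
  squareFree [] [] (() , _)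
  squareFree {p ∷ ps} ((x , root , later) ∷ _) (true ∷ s) _ square =
    square⇒¬SimpleRoot square (SimpleRoot-*ₚ root (selProd-NonRoot ps later s))
  squareFree (_ ∷ fresh) (false ∷ s) (fzero , ())
  squareFree (_ ∷ fresh) (false ∷ s) (fsuc i , there i∈s) = squareFree fresh s (i , i∈s)

-- Expressions in c, and polynomials in X over them: interpreted in F[X] they give the list
-- of the theorem on the nose, and translated to the ring solver they can be normalised.
infixl 6 _⊕_ _⊖_ _⊞_ _⊟_
infixl 7 _⊗_ _⊠_

data Scalar : Set where
  𝐜 𝟏         : Scalar
  _⊕_ _⊖_ _⊗_ : Scalar → Scalar → Scalar

𝟐 𝟑 𝟒 : Scalar
𝟐 = 𝟏 ⊕ 𝟏
𝟑 = 𝟐 ⊕ 𝟏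
𝟒 = 𝟑 ⊕ 𝟏

data PolyExpr : Set where
  𝐗           : PolyExpr
  𝐂           : Scalar → PolyExpr
  _⊞_ _⊟_ _⊠_ : PolyExpr → PolyExpr → PolyExpr

module Semantics {a ℓ} (F : Field a ℓ) (c : Field.Carrier F) where
  open Field F
  open Poly F

  ⟦_⟧ˢ : Scalar → Carrier
  ⟦ 𝐜 ⟧ˢ     = c
  ⟦ 𝟏 ⟧ˢ     = 1#
  ⟦ s ⊕ t ⟧ˢ = ⟦ s ⟧ˢ + ⟦ t ⟧ˢ
  ⟦ s ⊖ t ⟧ˢ = ⟦ s ⟧ˢ - ⟦ t ⟧ˢ
  ⟦ s ⊗ t ⟧ˢ = ⟦ s ⟧ˢ * ⟦ t ⟧ˢ

  ⟦_⟧ᵖ : PolyExpr → Pol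
  ⟦ 𝐗 ⟧ᵖ     = X
  ⟦ 𝐂 s ⟧ᵖ   = C ⟦ s ⟧ˢ
  ⟦ e ⊞ f ⟧ᵖ = ⟦ e ⟧ᵖ +ₚ ⟦ f ⟧ᵖ
  ⟦ e ⊟ f ⟧ᵖ = ⟦ e ⟧ᵖ -ₚ ⟦ f ⟧ᵖ
  ⟦ e ⊠ f ⟧ᵖ = ⟦ e ⟧ᵖ *ₚ ⟦ f ⟧ᵖ

𝟏ₚ : PolyExpr
𝟏ₚ = 𝐂 𝟏

𝐩₁ 𝐩₂ 𝐩₃ 𝐩₄ 𝐩₅ 𝐩₆ 𝐩₇ 𝐩₈ 𝐩₉ 𝐩₁₀ 𝐩₁₁ 𝐩₁₂ 𝐩₁₃ 𝐩₁₄ 𝐩₁₅ : PolyExpr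
𝐩₁  = 𝐗
𝐩₂  = 𝐗 ⊟ 𝟏ₚ
𝐩₃  = 𝐗 ⊟ 𝐂 𝐜
𝐩₄  = 𝐗 ⊟ 𝟏ₚ ⊟ 𝐂 𝐜
𝐩₅  = 𝐗 ⊞ 𝟏ₚ ⊟ 𝐂 𝐜
𝐩₆  = 𝐂 (𝟏 ⊖ 𝐜) ⊠ 𝐗 ⊟ 𝐂 𝐜
𝐩₇  = 𝐂 (𝟏 ⊕ 𝐜) ⊠ 𝐗 ⊟ 𝐂 𝐜
𝐩₈  = 𝐗 ⊠ 𝐗 ⊞ 𝐂 𝐜 ⊟ 𝐂 𝟐 ⊠ 𝐗
𝐩₉  = 𝐂 (𝐜 ⊗ 𝐜) ⊞ 𝐗 ⊟ 𝐂 (𝟐 ⊗ 𝐜)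
𝐩₁₀ = 𝐗 ⊠ 𝐗 ⊞ 𝐂 𝐜 ⊟ 𝐂 𝟐 ⊠ 𝐗 ⊠ 𝐂 𝐜
𝐩₁₁ = 𝐂 (𝐜 ⊗ 𝐜) ⊞ 𝐗 ⊟ 𝐂 𝟐 ⊠ 𝐗 ⊠ 𝐂 𝐜
𝐩₁₂ = 𝐗 ⊠ 𝐗 ⊞ 𝐂 (𝐜 ⊗ 𝐜) ⊟ 𝐗 ⊠ 𝐂 𝐜 ⊟ 𝐗
𝐩₁₃ = 𝐂 (𝐜 ⊗ 𝐜) ⊞ 𝐗 ⊠ 𝐗 ⊟ 𝐗 ⊠ 𝐂 𝐜 ⊟ 𝐂 𝐜
𝐩₁₄ = 𝐂 (𝐜 ⊗ 𝐜) ⊠ 𝐗 ⊞ 𝐗 ⊠ 𝐂 𝐜 ⊟ 𝐗 ⊠ 𝐗 ⊟ 𝐂 (𝐜 ⊗ 𝐜)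
𝐩₁₅ = 𝐗 ⊠ 𝐗 ⊠ 𝐂 𝐜 ⊞ 𝐗 ⊠ 𝐂 𝐜 ⊟ 𝐗 ⊠ 𝐗 ⊟ 𝐂 (𝐜 ⊗ 𝐜)

polynomials : List PolyExpr
polynomials = 𝐩₁ ∷ 𝐩₂ ∷ 𝐩₃ ∷ 𝐩₄ ∷ 𝐩₅ ∷ 𝐩₆ ∷ 𝐩₇ ∷ 𝐩₈ ∷ 𝐩₉ ∷ 𝐩₁₀ ∷ 𝐩₁₁ ∷ 𝐩₁₂ ∷ 𝐩₁₃ ∷ 𝐩₁₄ ∷ 𝐩₁₅ ∷ []

polynomials-denote-theList : ∀ {a ℓ} (F : Field a ℓ) c →
  List.map (Semantics.⟦_⟧ᵖ F c) polynomials ≡ TheList.theList F c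
polynomials-denote-theList F c = ≡.refl

data Factor : Set where
  [2] [c] [c+1] [c-1] [2c-1] [c-2] : Factor
  [c²+c+1] [c²+c-1] [c²-c+1] [c²-c-1] [c²-3c+1] : Factor
  [3c+1] [c+3] [3c-2] [2c-3] [3c-1] [c-3] [3c-4] [4c-3] : Factor
  [c²-3c+3] [3c²-3c+1] [c³+c²-1] [c³-c-1] [c²+1] [c²-2c+2] [2c²-2c+1] : Factor
  [c³-c²+2c-1] [c³-2c²+c-1] [c³-2c²+3c-1] [c³-3c²+2c-1] : Factor

factor : Factor → Scalar
factor [2]           = 𝟐
factor [c]           = 𝐜
factor [c+1]         = 𝐜 ⊕ 𝟏
factor [c-1]         = 𝐜 ⊖ 𝟏
factor [2c-1]        = 𝟐 ⊗ 𝐜 ⊖ 𝟏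
factor [c-2]         = 𝐜 ⊖ 𝟐
factor [c²+c+1]      = 𝐜 ⊗ 𝐜 ⊕ 𝐜 ⊕ 𝟏
factor [c²+c-1]      = 𝐜 ⊗ 𝐜 ⊕ 𝐜 ⊖ 𝟏
factor [c²-c+1]      = 𝐜 ⊗ 𝐜 ⊖ 𝐜 ⊕ 𝟏
factor [c²-c-1]      = 𝐜 ⊗ 𝐜 ⊖ 𝐜 ⊖ 𝟏
factor [c²-3c+1]     = 𝐜 ⊗ 𝐜 ⊖ 𝟑 ⊗ 𝐜 ⊕ 𝟏
factor [3c+1]        = 𝟑 ⊗ 𝐜 ⊕ 𝟏
factor [c+3]         = 𝐜 ⊕ 𝟑
factor [3c-2]        = 𝟑 ⊗ 𝐜 ⊖ 𝟐
factor [2c-3]        = 𝟐 ⊗ 𝐜 ⊖ 𝟑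
factor [3c-1]        = 𝟑 ⊗ 𝐜 ⊖ 𝟏
factor [c-3]         = 𝐜 ⊖ 𝟑
factor [3c-4]        = 𝟑 ⊗ 𝐜 ⊖ 𝟒
factor [4c-3]        = 𝟒 ⊗ 𝐜 ⊖ 𝟑
factor [c²-3c+3]     = 𝐜 ⊗ 𝐜 ⊖ 𝟑 ⊗ 𝐜 ⊕ 𝟑
factor [3c²-3c+1]    = 𝟑 ⊗ (𝐜 ⊗ 𝐜) ⊖ 𝟑 ⊗ 𝐜 ⊕ 𝟏
factor [c³+c²-1]     = 𝐜 ⊗ 𝐜 ⊗ 𝐜 ⊕ 𝐜 ⊗ 𝐜 ⊖ 𝟏
factor [c³-c-1]      = 𝐜 ⊗ 𝐜 ⊗ 𝐜 ⊖ 𝐜 ⊖ 𝟏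
factor [c²+1]        = 𝐜 ⊗ 𝐜 ⊕ 𝟏
factor [c²-2c+2]     = 𝐜 ⊗ 𝐜 ⊖ 𝟐 ⊗ 𝐜 ⊕ 𝟐
factor [2c²-2c+1]    = 𝟐 ⊗ (𝐜 ⊗ 𝐜) ⊖ 𝟐 ⊗ 𝐜 ⊕ 𝟏
factor [c³-c²+2c-1]  = 𝐜 ⊗ 𝐜 ⊗ 𝐜 ⊖ 𝐜 ⊗ 𝐜 ⊕ 𝟐 ⊗ 𝐜 ⊖ 𝟏
factor [c³-2c²+c-1]  = 𝐜 ⊗ 𝐜 ⊗ 𝐜 ⊖ 𝟐 ⊗ (𝐜 ⊗ 𝐜) ⊕ 𝐜 ⊖ 𝟏
factor [c³-2c²+3c-1] = 𝐜 ⊗ 𝐜 ⊗ 𝐜 ⊖ 𝟐 ⊗ (𝐜 ⊗ 𝐜) ⊕ 𝟑 ⊗ 𝐜 ⊖ 𝟏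
factor [c³-3c²+2c-1] = 𝐜 ⊗ 𝐜 ⊗ 𝐜 ⊖ 𝟑 ⊗ (𝐜 ⊗ 𝐜) ⊕ 𝟐 ⊗ 𝐜 ⊖ 𝟏

NonvanishingFactors : ∀ {a ℓ} (F : Field a ℓ) → Field.Carrier F → Set ℓ
NonvanishingFactors F c = ∀ f → ¬ Semantics.⟦_⟧ˢ F c (factor f) ≈ 0#
  where open Field F

module Certificates {a ℓ} (K : Field a ℓ) where
  open Field K using (commutativeRing)
  open IntegerCoefficients commutativeRing public
    using ( Polynomial; op; con; var; _:+_; _:*_; _:-_; :-_; _:^_; normalise
          ; literal; negativeLiteral)

  open import Agda.Builtin.FromNat using (fromNat)
  open import Agda.Builtin.FromNeg using (fromNeg)
  import Data.Nat.Literals as ℕ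
  open ≡ using (refl)

  -- Overloaded literals denote constant polynomials; ℕ then needs its instance too.
  instance
    natural : Number ℕ
    natural = ℕ.number

  -- Variables are ordered (c , x), so that coefficients in c alone are polynomials in one
  -- variable.
  c : ∀ {n} → Polynomial (suc n)
  c = var fzero

  x : Polynomial 2
  x = var (fsuc fzero)

  scalar : ∀ {n} → Scalar → Polynomial (suc n)
  scalar 𝐜       = c
  scalar 𝟏       = 1
  scalar (s ⊕ t) = scalar s :+ scalar t
  scalar (s ⊖ t) = scalar s :- scalar t
  scalar (s ⊗ t) = scalar s :* scalar t

  poly : PolyExpr → Polynomial 2
  poly 𝐗       = x
  poly (𝐂 s)   = scalar s
  poly (e ⊞ f) = poly e :+ poly f
  poly (e ⊟ f) = poly e :- poly f
  poly (e ⊠ f) = poly e :* poly f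

  derivative : PolyExpr → Polynomial 2
  derivative 𝐗       = 1
  derivative (𝐂 s)   = 0
  derivative (e ⊞ f) = derivative e :+ derivative f
  derivative (e ⊟ f) = derivative e :- derivative f
  derivative (e ⊠ f) = derivative e :* poly f :+ poly e :* derivative f

  product : ∀ {n} → List Factor → Polynomial (suc n)
  product []       = 1
  product (f ∷ fs) = scalar (factor f) :* product fs

  lift : Polynomial 1 → Polynomial 2
  lift (op o p q) = op o (lift p) (lift q)
  lift (con k)    = con k
  lift (var i)    = var (Fin.inject₁ i)
  lift (p :^ k)   = lift p :^ k
  lift (:- p)     = :- lift p

  horner : List (Polynomial 1) → Polynomial 2
  horner []       = 0
  horner (t ∷ ts) = lift t :+ x :* horner ts

  record NonVanishing (t : Polynomial 1) : Set where
    constructor nonVanishing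
    field
      unit     : Polynomial 1
      factors  : List Factor
      identity : normalise (unit :* t) ≡ normalise (product factors)

  record Bezout (p q : Polynomial 2) : Set where
    constructor bezout
    field
      u v      : Polynomial 2
      factors  : List Factor
      identity : normalise (u :* p :+ v :* q) ≡ normalise (product factors)

  -- lower and top are the coefficients of e in x, constant term first; since top ≉ 0 the
  -- degree is positive, so e has a root in an algebraically closed field.
  record Certificate (e : PolyExpr) (later : List PolyExpr) : Set where
    field
      lower     : List⁺ (Polynomial 1)
      top       : Polynomial 1
      top≉0     : NonVanishing top
      expansion : normalise (poly e) ≡ normalise (horner (List⁺.toList lower List.++ top ∷ []))
      simple    : Bezout (poly e) (derivative e)
      coprime   : All (Bezout (poly e) ∘ poly) later

  data Certified : List PolyExpr → Set where
    []  : Certified []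
    _∷_ : ∀ {e es} → Certificate e es → Certified es → Certified (e ∷ es)

  certificate₁ : Certificate 𝐩₁ (𝐩₂ ∷ 𝐩₃ ∷ 𝐩₄ ∷ 𝐩₅ ∷ 𝐩₆ ∷ 𝐩₇ ∷ 𝐩₈
                                 ∷ 𝐩₉ ∷ 𝐩₁₀ ∷ 𝐩₁₁ ∷ 𝐩₁₂ ∷ 𝐩₁₃ ∷ 𝐩₁₄ ∷ 𝐩₁₅ ∷ [])
  certificate₁ = record
    { lower     = 0 ∷ []
    ; top       = 1
    ; top≉0     = nonVanishing 1 [] refl
    ; expansion = refl
    ; simple    = bezout 0 1 [] refl
    ; coprime   = bezout 1 -1 [] refl
                ∷ bezout 1 -1 ([c] ∷ []) refl
                ∷ bezout 1 -1 ([c+1] ∷ []) refl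
                ∷ bezout 1 -1 ([c-1] ∷ []) refl
                ∷ bezout (1 :- c) -1 ([c] ∷ []) refl
                ∷ bezout (1 :+ c) -1 ([c] ∷ []) refl
                ∷ bezout (2 :- x) 1 ([c] ∷ []) refl
                ∷ bezout -1 1 ([c] ∷ [c-2] ∷ []) refl
                ∷ bezout (2 :* c :- x) 1 ([c] ∷ []) refl
                ∷ bezout (-1 :+ 2 :* c) 1 ([c] ∷ [c] ∷ []) refl
                ∷ bezout (1 :+ c :- x) 1 ([c] ∷ [c] ∷ []) refl
                ∷ bezout (c :- x) 1 ([c] ∷ [c-1] ∷ []) refl
                ∷ bezout (c :+ c :^ 2 :- x) -1 ([c] ∷ [c] ∷ []) refl
                ∷ bezout (c :- x :+ c :* x) -1 ([c] ∷ [c] ∷ []) refl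
                ∷ []
    }

  certificate₂ : Certificate 𝐩₂ (𝐩₃ ∷ 𝐩₄ ∷ 𝐩₅ ∷ 𝐩₆ ∷ 𝐩₇ ∷ 𝐩₈
                                 ∷ 𝐩₉ ∷ 𝐩₁₀ ∷ 𝐩₁₁ ∷ 𝐩₁₂ ∷ 𝐩₁₃ ∷ 𝐩₁₄ ∷ 𝐩₁₅ ∷ [])
  certificate₂ = record
    { lower     = -1 ∷ []
    ; top       = 1
    ; top≉0     = nonVanishing 1 [] refl
    ; expansion = refl
    ; simple    = bezout 0 1 [] refl
    ; coprime   = bezout 1 -1 ([c-1] ∷ []) refl
                ∷ bezout 1 -1 ([c] ∷ []) refl
                ∷ bezout 1 -1 ([c-2] ∷ []) refl
                ∷ bezout (1 :- c) -1 ([2c-1] ∷ []) refl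
                ∷ bezout (-1 :- c) 1 [] refl
                ∷ bezout (1 :- x) 1 ([c-1] ∷ []) refl
                ∷ bezout -1 1 ([c-1] ∷ [c-1] ∷ []) refl
                ∷ bezout (1 :- 2 :* c :+ x) -1 ([c-1] ∷ []) refl
                ∷ bezout (-1 :+ 2 :* c) 1 ([c-1] ∷ [c-1] ∷ []) refl
                ∷ bezout (c :- x) 1 ([c] ∷ [c-1] ∷ []) refl
                ∷ bezout (-1 :+ c :- x) 1 ([c-1] ∷ [c-1] ∷ []) refl
                ∷ bezout (1 :- c :- c :^ 2 :+ x) 1 ([c-1] ∷ []) refl
                ∷ bezout (-1 :+ 2 :* c :- x :+ c :* x) -1 ([c-1] ∷ [c-1] ∷ []) refl
                ∷ []
    }

  certificate₃ : Certificate 𝐩₃ (𝐩₄ ∷ 𝐩₅ ∷ 𝐩₆ ∷ 𝐩₇ ∷ 𝐩₈ ∷ 𝐩₉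
                                 ∷ 𝐩₁₀ ∷ 𝐩₁₁ ∷ 𝐩₁₂ ∷ 𝐩₁₃ ∷ 𝐩₁₄ ∷ 𝐩₁₅ ∷ [])
  certificate₃ = record
    { lower     = (:- c) ∷ []
    ; top       = 1
    ; top≉0     = nonVanishing 1 [] refl
    ; expansion = refl
    ; simple    = bezout 0 1 [] refl
    ; coprime   = bezout 1 -1 [] refl
                ∷ bezout -1 1 [] refl
                ∷ bezout (1 :- c) -1 ([c] ∷ [c] ∷ []) refl
                ∷ bezout (-1 :- c) 1 ([c] ∷ [c] ∷ []) refl
                ∷ bezout (2 :- c :- x) 1 ([c] ∷ [c-1] ∷ []) refl
                ∷ bezout -1 1 ([c] ∷ [c-1] ∷ []) refl
                ∷ bezout (:- c :+ x) -1 ([c] ∷ [c-1] ∷ []) refl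
                ∷ bezout (1 :- 2 :* c) -1 ([c] ∷ [c-1] ∷ []) refl
                ∷ bezout (1 :- x) 1 ([c] ∷ [c-1] ∷ []) refl
                ∷ bezout (:- x) 1 ([c] ∷ [c-1] ∷ []) refl
                ∷ bezout (:- c :^ 2 :+ x) 1 ([c] ∷ [c] ∷ [c-1] ∷ []) refl
                ∷ bezout (:- c :^ 2 :+ x :- c :* x) 1 ([c] ∷ [c] ∷ [c-1] ∷ []) refl
                ∷ []
    }

  certificate₄ : Certificate 𝐩₄ (𝐩₅ ∷ 𝐩₆ ∷ 𝐩₇ ∷ 𝐩₈ ∷ 𝐩₉ ∷ 𝐩₁₀ ∷ 𝐩₁₁ ∷ 𝐩₁₂ ∷ 𝐩₁₃ ∷ 𝐩₁₄ ∷ 𝐩₁₅ ∷ [])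
  certificate₄ = record
    { lower     = (-1 :- c) ∷ []
    ; top       = 1
    ; top≉0     = nonVanishing 1 [] refl
    ; expansion = refl
    ; simple    = bezout 0 1 [] refl
    ; coprime   = bezout -1 1 ([2] ∷ []) refl
                ∷ bezout (1 :- c) -1 ([c²+c-1] ∷ []) refl
                ∷ bezout (-1 :- c) 1 ([c²+c+1] ∷ []) refl
                ∷ bezout (1 :- c :- x) 1 ([c²+c-1] ∷ []) refl
                ∷ bezout -1 1 ([c²-c+1] ∷ []) refl
                ∷ bezout (1 :- c :+ x) -1 ([c²-c-1] ∷ []) refl
                ∷ bezout (1 :- 2 :* c) -1 ([c²+c-1] ∷ []) refl
                ∷ bezout (:- x) 1 ([c] ∷ [c] ∷ []) refl
                ∷ bezout (-1 :- x) 1 ([c²+1] ∷ []) refl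
                ∷ bezout (1 :- c :^ 2 :+ x) 1 ([c³-c-1] ∷ []) refl
                ∷ bezout (1 :- c :- c :^ 2 :+ x :- c :* x) 1 ([c³+c²-1] ∷ []) refl
                ∷ []
    }

  certificate₅ : Certificate 𝐩₅ (𝐩₆ ∷ 𝐩₇ ∷ 𝐩₈ ∷ 𝐩₉ ∷ 𝐩₁₀ ∷ 𝐩₁₁ ∷ 𝐩₁₂ ∷ 𝐩₁₃ ∷ 𝐩₁₄ ∷ 𝐩₁₅ ∷ [])
  certificate₅ = record
    { lower     = (1 :- c) ∷ []
    ; top       = 1
    ; top≉0     = nonVanishing 1 [] refl
    ; expansion = refl
    ; simple    = bezout 0 1 [] refl
    ; coprime   = bezout (1 :- c) -1 ([c²-c+1] ∷ []) refl
                ∷ bezout (-1 :- c) 1 ([c²-c-1] ∷ []) refl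
                ∷ bezout (3 :- c :- x) 1 ([c²-3c+3] ∷ []) refl
                ∷ bezout -1 1 ([c²-c-1] ∷ []) refl
                ∷ bezout (-1 :- c :+ x) -1 ([c²-c-1] ∷ []) refl
                ∷ bezout (1 :- 2 :* c) -1 ([c²-3c+1] ∷ []) refl
                ∷ bezout (2 :- x) 1 ([c²-2c+2] ∷ []) refl
                ∷ bezout (1 :- x) 1 ([c-1] ∷ [c-1] ∷ []) refl
                ∷ bezout (-1 :- c :^ 2 :+ x) 1 ([c³-2c²+c-1] ∷ []) refl
                ∷ bezout (-1 :+ c :- c :^ 2 :+ x :- c :* x) 1 ([c³-3c²+2c-1] ∷ []) refl
                ∷ []
    }

  certificate₆ : Certificate 𝐩₆ (𝐩₇ ∷ 𝐩₈ ∷ 𝐩₉ ∷ 𝐩₁₀ ∷ 𝐩₁₁ ∷ 𝐩₁₂ ∷ 𝐩₁₃ ∷ 𝐩₁₄ ∷ 𝐩₁₅ ∷ [])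
  certificate₆ = record
    { lower     = (:- c) ∷ []
    ; top       = 1 :- c
    ; top≉0     = nonVanishing -1 ([c-1] ∷ []) refl
    ; expansion = refl
    ; simple    = bezout 0 -1 ([c-1] ∷ []) refl
    ; coprime   = bezout (-1 :- c) (1 :- c) ([c] ∷ [c] ∷ [2] ∷ []) refl
                ∷ bezout (2 :- 3 :* c :- x :+ c :* x)
                         (1 :- 2 :* c :+ c :^ 2)
                         ([c] ∷ [c²+c-1] ∷ []) refl
                ∷ bezout 1 (-1 :+ c) ([c] ∷ [c²-3c+1] ∷ []) refl
                ∷ bezout (c :- 2 :* c :^ 2 :- x :+ c :* x)
                         (1 :- 2 :* c :+ c :^ 2)
                         ([c] ∷ [3c²-3c+1] ∷ []) refl
                ∷ bezout (1 :- 2 :* c) (-1 :+ c) ([c] ∷ [c²+c-1] ∷ []) refl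
                ∷ bezout (1 :- c :- c :^ 2 :- x :+ c :* x)
                         (1 :- 2 :* c :+ c :^ 2)
                         ([c] ∷ [c³-c²+2c-1] ∷ []) refl
                ∷ bezout (:- c :^ 2 :- x :+ c :* x)
                         (1 :- 2 :* c :+ c :^ 2)
                         ([c] ∷ [c³-2c²+3c-1] ∷ []) refl
                ∷ bezout (:- c :^ 3 :- x :+ c :* x)
                         (-1 :+ 2 :* c :- c :^ 2)
                         ([c] ∷ [c] ∷ [2c²-2c+1] ∷ []) refl
                ∷ bezout (:- x :+ 2 :* c :* x :- c :^ 2 :* x)
                         (-1 :+ 2 :* c :- c :^ 2)
                         ([c] ∷ [c] ∷ [c-1] ∷ [c-1] ∷ []) refl
                ∷ []
    }

  certificate₇ : Certificate 𝐩₇ (𝐩₈ ∷ 𝐩₉ ∷ 𝐩₁₀ ∷ 𝐩₁₁ ∷ 𝐩₁₂ ∷ 𝐩₁₃ ∷ 𝐩₁₄ ∷ 𝐩₁₅ ∷ [])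
  certificate₇ = record
    { lower     = (:- c) ∷ []
    ; top       = 1 :+ c
    ; top≉0     = nonVanishing 1 ([c+1] ∷ []) refl
    ; expansion = refl
    ; simple    = bezout 0 1 ([c+1] ∷ []) refl
    ; coprime   = bezout (2 :+ c :- x :- c :* x) (1 :+ 2 :* c :+ c :^ 2) ([c] ∷ [c²+c-1] ∷ []) refl
                ∷ bezout -1 (1 :+ c) ([c] ∷ [c²-c-1] ∷ []) refl
                ∷ bezout (:- c :- 2 :* c :^ 2 :+ x :+ c :* x)
                         (-1 :- 2 :* c :- c :^ 2)
                         ([c] ∷ [c²-c-1] ∷ []) refl
                ∷ bezout (-1 :+ 2 :* c) (1 :+ c) ([c] ∷ [c²-c+1] ∷ []) refl
                ∷ bezout (1 :+ c :+ c :^ 2 :- x :- c :* x)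
                         (1 :+ 2 :* c :+ c :^ 2)
                         ([c] ∷ [c³+c²-1] ∷ []) refl
                ∷ bezout (c :^ 2 :- x :- c :* x) (1 :+ 2 :* c :+ c :^ 2) ([c] ∷ [c³-c-1] ∷ []) refl
                ∷ bezout (2 :* c :^ 2 :+ c :^ 3 :- x :- c :* x)
                         (-1 :- 2 :* c :- c :^ 2)
                         ([c] ∷ [c] ∷ []) refl
                ∷ bezout (2 :* c :^ 2 :- x :+ c :^ 2 :* x)
                         (-1 :- 2 :* c :- c :^ 2)
                         ([c] ∷ [c] ∷ [c²+1] ∷ []) refl
                ∷ []
    }

  certificate₈ : Certificate 𝐩₈ (𝐩₉ ∷ 𝐩₁₀ ∷ 𝐩₁₁ ∷ 𝐩₁₂ ∷ 𝐩₁₃ ∷ 𝐩₁₄ ∷ 𝐩₁₅ ∷ [])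
  certificate₈ = record
    { lower     = c ∷ -2 ∷ []
    ; top       = 1
    ; top≉0     = nonVanishing 1 [] refl
    ; expansion = refl
    ; simple    = bezout 4 (2 :- 2 :* x) ([c-1] ∷ [2] ∷ [2] ∷ []) refl
    ; coprime   = bezout 1 (2 :- 2 :* c :+ c :^ 2 :- x) ([c] ∷ [c-1] ∷ [c²-3c+3] ∷ []) refl
                ∷ bezout (-4 :* c :+ 4 :* c :^ 2 :+ 2 :* x :- 2 :* c :* x)
                         (4 :- 4 :* c :- 2 :* x :+ 2 :* c :* x)
                         ([c] ∷ [c-1] ∷ [c-1] ∷ [2] ∷ [2] ∷ []) refl
                ∷ bezout (1 :- 4 :* c :+ 4 :* c :^ 2)
                         (2 :- 4 :* c :+ c :^ 2 :- x :+ 2 :* c :* x)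
                         ([c] ∷ [c-1] ∷ [c²+c-1] ∷ []) refl
                ∷ bezout (-1 :+ c :+ x :- c :* x)
                         (2 :- 3 :* c :+ c :^ 2 :- x :+ c :* x)
                         ([c] ∷ [c-1] ∷ [c-1] ∷ [c-1] ∷ []) refl
                ∷ bezout (2 :* x :- c :* x)
                         (4 :- 4 :* c :+ c :^ 2 :- 2 :* x :+ c :* x)
                         ([c] ∷ [c-1] ∷ [c-2] ∷ [c-2] ∷ []) refl
                ∷ bezout (:- c :- 2 :* c :^ 2 :+ 2 :* c :^ 3 :+ c :^ 4 :+ 2 :* x :- c :* x :- c :^ 2 :* x)
                         (-4 :+ 3 :* c :+ c :^ 2 :+ 2 :* x :- c :* x :- c :^ 2 :* x)
                         ([c] ∷ [c] ∷ [c-1] ∷ [c-1] ∷ [c+3] ∷ []) refl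
                ∷ bezout (:- c :+ 2 :* c :^ 3 :+ 2 :* x :- 5 :* c :* x :+ 3 :* c :^ 2 :* x)
                         (-4 :+ 7 :* c :- 2 :* c :^ 2 :+ 2 :* x :- 3 :* c :* x)
                         ([c] ∷ [c] ∷ [c-1] ∷ [4c-3] ∷ []) refl
                ∷ []
    }

  certificate₉ : Certificate 𝐩₉ (𝐩₁₀ ∷ 𝐩₁₁ ∷ 𝐩₁₂ ∷ 𝐩₁₃ ∷ 𝐩₁₄ ∷ 𝐩₁₅ ∷ [])
  certificate₉ = record
    { lower     = (-2 :* c :+ c :^ 2) ∷ []
    ; top       = 1
    ; top≉0     = nonVanishing 1 [] refl
    ; expansion = refl
    ; simple    = bezout 0 1 [] refl
    ; coprime   = bezout (c :^ 2 :- x) 1 ([c] ∷ [c-1] ∷ [c²-c-1] ∷ []) refl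
                ∷ bezout (-1 :+ 2 :* c) 1 ([c] ∷ [c-1] ∷ [c-1] ∷ [2] ∷ []) refl
                ∷ bezout (1 :- c :+ c :^ 2 :- x) 1 ([c] ∷ [c-1] ∷ [c²-2c+2] ∷ []) refl
                ∷ bezout (:- c :+ c :^ 2 :- x) 1 ([c] ∷ [c-1] ∷ [c-1] ∷ [c-1] ∷ []) refl
                ∷ bezout (:- c :+ 2 :* c :^ 2 :- x) -1 ([c] ∷ [c] ∷ [c-1] ∷ [2c-3] ∷ []) refl
                ∷ bezout (c :- 3 :* c :^ 2 :+ c :^ 3 :+ x :- c :* x)
                         1
                         ([c] ∷ [c] ∷ [c-1] ∷ [c-1] ∷ [c-3] ∷ []) refl
                ∷ []
    }

  certificate₁₀ : Certificate 𝐩₁₀ (𝐩₁₁ ∷ 𝐩₁₂ ∷ 𝐩₁₃ ∷ 𝐩₁₄ ∷ 𝐩₁₅ ∷ [])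
  certificate₁₀ = record
    { lower     = c ∷ (-2 :* c) ∷ []
    ; top       = 1
    ; top≉0     = nonVanishing 1 [] refl
    ; expansion = refl
    ; simple    = bezout -4 (-2 :* c :+ 2 :* x) ([c] ∷ [c-1] ∷ [2] ∷ [2] ∷ []) refl
    ; coprime   = bezout (-1 :+ 4 :* c :- 4 :* c :^ 2)
                         (-2 :* c :+ 3 :* c :^ 2 :+ x :- 2 :* c :* x)
                         ([c] ∷ [c-1] ∷ [3c²-3c+1] ∷ []) refl
                ∷ bezout (1 :+ c :- 2 :* c :^ 2 :- x :+ c :* x)
                         (-3 :* c :+ 3 :* c :^ 2 :+ x :- c :* x)
                         ([c] ∷ [c-1] ∷ [c-1] ∷ [3c+1] ∷ []) refl
                ∷ bezout (2 :* c :- 2 :* c :^ 2 :+ c :* x)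
                         (-2 :* c :+ 3 :* c :^ 2 :- c :* x)
                         ([c] ∷ [c] ∷ [c-1] ∷ [3c-4] ∷ []) refl
                ∷ bezout (:- c :+ 2 :* c :^ 2 :- c :^ 4 :- c :* x :+ c :^ 2 :* x)
                         (:- c :+ 3 :* c :^ 2 :- 2 :* c :^ 3 :- c :* x :+ c :^ 2 :* x)
                         ([c] ∷ [c] ∷ [c-1] ∷ [c-1] ∷ [c-1] ∷ []) refl
                ∷ bezout (:- c :+ 4 :* c :^ 2 :- 4 :* c :^ 3 :- c :* x :+ 3 :* c :^ 2 :* x :- 2 :* c :^ 3 :* x)
                         (:- c :+ 4 :* c :^ 2 :- 4 :* c :^ 3 :- c :* x :+ 2 :* c :^ 2 :* x)
                         ([c] ∷ [c] ∷ [c-1] ∷ [2c-1] ∷ [2c-1] ∷ []) refl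
                ∷ []
    }

  certificate₁₁ : Certificate 𝐩₁₁ (𝐩₁₂ ∷ 𝐩₁₃ ∷ 𝐩₁₄ ∷ 𝐩₁₅ ∷ [])
  certificate₁₁ = record
    { lower     = (c :^ 2) ∷ []
    ; top       = 1 :- 2 :* c
    ; top≉0     = nonVanishing -1 ([2c-1] ∷ []) refl
    ; expansion = refl
    ; simple    = bezout 0 -1 ([2c-1] ∷ []) refl
    ; coprime   = bezout (1 :- c :- c :^ 2 :- x :+ 2 :* c :* x)
                         (1 :- 4 :* c :+ 4 :* c :^ 2)
                         ([c] ∷ [c] ∷ [c-1] ∷ [3c-2] ∷ []) refl
                ∷ bezout (c :- c :^ 2 :- x :+ 2 :* c :* x)
                         (1 :- 4 :* c :+ 4 :* c :^ 2)
                         ([c] ∷ [c-1] ∷ [c-1] ∷ [3c-1] ∷ []) refl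
                ∷ bezout (:- c :+ 2 :* c :^ 3 :+ x :- 2 :* c :* x)
                         (1 :- 4 :* c :+ 4 :* c :^ 2)
                         ([c] ∷ [c] ∷ [c-1] ∷ [2c²-2c+1] ∷ []) refl
                ∷ bezout (:- c :+ c :^ 2 :+ c :^ 3 :+ x :- 3 :* c :* x :+ 2 :* c :^ 2 :* x)
                         (1 :- 4 :* c :+ 4 :* c :^ 2)
                         ([c] ∷ [c] ∷ [c-1] ∷ [c-1] ∷ [c-1] ∷ []) refl
                ∷ []
    }

  certificate₁₂ : Certificate 𝐩₁₂ (𝐩₁₃ ∷ 𝐩₁₄ ∷ 𝐩₁₅ ∷ [])
  certificate₁₂ = record
    { lower     = (c :^ 2) ∷ (-1 :- c) ∷ []
    ; top       = 1
    ; top≉0     = nonVanishing 1 [] refl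
    ; expansion = refl
    ; simple    = bezout 4 (1 :+ c :- 2 :* x) ([c-1] ∷ [3c+1] ∷ []) refl
    ; coprime   = bezout x (1 :- x) ([c] ∷ [c-1] ∷ []) refl
                ∷ bezout (:- c :- c :^ 2 :+ c :^ 3 :+ c :^ 4 :+ x :- c :^ 2 :* x)
                         (-1 :- c :+ c :^ 2 :+ c :^ 3 :+ x :- c :^ 2 :* x)
                         ([c] ∷ [c] ∷ [c+1] ∷ [c+1] ∷ [c-1] ∷ [c-1] ∷ []) refl
                ∷ bezout (:- c :+ c :^ 2 :+ c :^ 4 :+ x :- 2 :* c :* x :+ c :^ 3 :* x)
                         (-1 :+ 2 :* c :^ 2 :+ x :- c :* x :- c :^ 2 :* x)
                         ([c] ∷ [c] ∷ [c-1] ∷ [c³+c²-1] ∷ []) refl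
                ∷ []
    }

  certificate₁₃ : Certificate 𝐩₁₃ (𝐩₁₄ ∷ 𝐩₁₅ ∷ [])
  certificate₁₃ = record
    { lower     = (:- c :+ c :^ 2) ∷ (:- c) ∷ []
    ; top       = 1
    ; top≉0     = nonVanishing 1 [] refl
    ; expansion = refl
    ; simple    = bezout 4 (c :- 2 :* x) ([c] ∷ [3c-4] ∷ []) refl
    ; coprime   = bezout (:- c :+ c :^ 3 :+ c :^ 4 :- c :^ 2 :* x)
                         (:- c :+ c :^ 3 :- c :^ 2 :* x)
                         ([c] ∷ [c] ∷ [c-1] ∷ [c³-c-1] ∷ []) refl
                ∷ bezout (:- c :+ 2 :* c :^ 2 :- c :^ 3 :+ c :^ 4 :- c :^ 2 :* x :+ c :^ 3 :* x)
                         (:- c :+ c :^ 2 :- c :^ 2 :* x)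
                         ([c] ∷ [c] ∷ [c-1] ∷ [c-1] ∷ [c²+1] ∷ []) refl
                ∷ []
    }

  certificate₁₄ : Certificate 𝐩₁₄ (𝐩₁₅ ∷ [])
  certificate₁₄ = record
    { lower     = (:- c :^ 2) ∷ (c :+ c :^ 2) ∷ []
    ; top       = -1
    ; top≉0     = nonVanishing -1 [] refl
    ; expansion = refl
    ; simple    = bezout 4 (c :+ c :^ 2 :- 2 :* x) ([c] ∷ [c] ∷ [c-1] ∷ [c+3] ∷ []) refl
    ; coprime   = bezout (:- c :^ 3 :+ 2 :* c :^ 4 :- c :^ 3 :* x :+ c :^ 4 :* x)
                         (c :^ 3 :- c :^ 4 :- c :^ 5 :+ c :^ 3 :* x)
                         ([c] ∷ [c] ∷ [c] ∷ [c] ∷ [c] ∷ [c] ∷ [c-1] ∷ []) refl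
                ∷ []
    }

  certificate₁₅ : Certificate 𝐩₁₅ []
  certificate₁₅ = record
    { lower     = (:- c :^ 2) ∷ c ∷ []
    ; top       = -1 :+ c
    ; top≉0     = nonVanishing 1 ([c-1] ∷ []) refl
    ; expansion = refl
    ; simple    = bezout (-4 :+ 8 :* c :- 4 :* c :^ 2)
                         (:- c :+ c :^ 2 :+ 2 :* x :- 4 :* c :* x :+ 2 :* c :^ 2 :* x)
                         ([c] ∷ [c] ∷ [c-1] ∷ [4c-3] ∷ []) refl
    ; coprime   = []
    }

  certified : Certified polynomials
  certified = certificate₁ ∷ certificate₂ ∷ certificate₃ ∷ certificate₄ ∷ certificate₅
            ∷ certificate₆ ∷ certificate₇ ∷ certificate₈ ∷ certificate₉ ∷ certificate₁₀
            ∷ certificate₁₁ ∷ certificate₁₂ ∷ certificate₁₃ ∷ certificate₁₄ ∷ certificate₁₅ ∷ []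

module Soundness {a ℓ} (K : Field a ℓ) (γ : Field.Carrier K)
  (factor≉0 : NonvanishingFactors K γ) where
  open Field K
  open Semantics K γ using (⟦_⟧ˢ)
  open Poly K using (eval)
  open Certificates K
  open IntegerCoefficients commutativeRing using (⟦_⟧; ⟦_⟧N; prove; [+]; [*])
  open FieldProperties K using (*-≉0)
  open import Algebra.Properties.Semiring.Exp semiring using (^-congˡ)
  open import Relation.Binary.Reasoning.Setoid setoid

  normalise-sound : ∀ {n} (p q : Polynomial n) → normalise p ≡ normalise q →
                    ∀ ρ → ⟦ p ⟧ ρ ≈ ⟦ q ⟧ ρ
  normalise-sound p q p≡q ρ = prove ρ p q (reflexive (≡.cong (λ n → ⟦ n ⟧N ρ) p≡q))

  ⟦scalar⟧ : ∀ {n} s (ρ : Vec Carrier n) → ⟦ scalar s ⟧ (γ ∷ ρ) ≈ ⟦ s ⟧ˢ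
  ⟦scalar⟧ 𝐜       ρ = refl
  ⟦scalar⟧ 𝟏       ρ = refl
  ⟦scalar⟧ (s ⊕ t) ρ = +-cong (⟦scalar⟧ s ρ) (⟦scalar⟧ t ρ)
  ⟦scalar⟧ (s ⊖ t) ρ = +-cong (⟦scalar⟧ s ρ) (-‿cong (⟦scalar⟧ t ρ))
  ⟦scalar⟧ (s ⊗ t) ρ = *-cong (⟦scalar⟧ s ρ) (⟦scalar⟧ t ρ)

  ⟦lift⟧ : ∀ t α → ⟦ lift t ⟧ (γ ∷ α ∷ []) ≈ ⟦ t ⟧ (γ ∷ [])
  ⟦lift⟧ (op [+] p q) α = +-cong (⟦lift⟧ p α) (⟦lift⟧ q α)
  ⟦lift⟧ (op [*] p q) α = *-cong (⟦lift⟧ p α) (⟦lift⟧ q α)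
  ⟦lift⟧ (con k)      α = refl
  ⟦lift⟧ (var fzero)  α = refl
  ⟦lift⟧ (p :^ k)     α = ^-congˡ k (⟦lift⟧ p α)
  ⟦lift⟧ (:- p)       α = -‿cong (⟦lift⟧ p α)

  ⟦horner⟧ : ∀ ts α → ⟦ horner ts ⟧ (γ ∷ α ∷ []) ≈ eval (List.map (λ t → ⟦ t ⟧ (γ ∷ [])) ts) α
  ⟦horner⟧ []       α = refl
  ⟦horner⟧ (t ∷ ts) α = +-cong (⟦lift⟧ t α) (*-congˡ (⟦horner⟧ ts α))

  product≉0 : ∀ {n} fs (ρ : Vec Carrier n) → ¬ ⟦ product fs ⟧ (γ ∷ ρ) ≈ 0#
  product≉0 []       ρ = 1≉0
  product≉0 (f ∷ fs) ρ =
    *-≉0 (factor≉0 f ∘ trans (sym (⟦scalar⟧ (factor f) ρ))) (product≉0 fs ρ)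

  NonVanishing-sound : ∀ {t} → NonVanishing t → ¬ ⟦ t ⟧ (γ ∷ []) ≈ 0#
  NonVanishing-sound {t} (nonVanishing u fs u·t≡∏) t≈0 = product≉0 fs [] (begin
    ⟦ product fs ⟧ (γ ∷ [])          ≈⟨ normalise-sound (u :* t) (product fs) u·t≡∏ (γ ∷ []) ⟨
    ⟦ u ⟧ (γ ∷ []) * ⟦ t ⟧ (γ ∷ [])  ≈⟨ *-congˡ t≈0 ⟩
    ⟦ u ⟧ (γ ∷ []) * 0#              ≈⟨ zeroʳ _ ⟩
    0#                               ∎)

  Bezout-sound : ∀ {p q} → Bezout p q → ∀ α → let ρ = γ ∷ α ∷ [] in
                 ⟦ p ⟧ ρ ≈ 0# → ¬ ⟦ q ⟧ ρ ≈ 0#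
  Bezout-sound {p} {q} (bezout u v fs up+vq≡∏) α p≈0 q≈0 = product≉0 fs (α ∷ []) (begin
    ⟦ product fs ⟧ ρ
      ≈⟨ normalise-sound (u :* p :+ v :* q) (product fs) up+vq≡∏ ρ ⟨
    ⟦ u ⟧ ρ * ⟦ p ⟧ ρ + ⟦ v ⟧ ρ * ⟦ q ⟧ ρ    ≈⟨ +-cong (*-congˡ p≈0) (*-congˡ q≈0) ⟩
    ⟦ u ⟧ ρ * 0# + ⟦ v ⟧ ρ * 0#              ≈⟨ +-cong (zeroʳ _) (zeroʳ _) ⟩
    0# + 0#                                  ≈⟨ +-identityʳ 0# ⟩
    0#                                       ∎)
    where
    ρ : Vec Carrier 2
    ρ = γ ∷ α ∷ []

module RootsFromCertificates {a ℓ} {F K : Field a ℓ} {ι : Field.Carrier F → Field.Carrier K}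
  (ι-hom : IsFieldHom F K ι) (c : Field.Carrier F) (closed : AlgebraicallyClosed K)
  (factor≉0 : NonvanishingFactors F c) where
  open Field K
  open Poly K using (Pol; eval; coeff; NonConstant)
  open Poly F using (negₚ)
  open RingMorphisms (Field.rawRing F) (Field.rawRing K)
  open IsRingHomomorphism ι-hom
  open Evaluation {F = F} {K = K} ι-hom
  module Kᵉ = Evaluation {F = K} {K = K} (Identity.isRingHomomorphism rawRing refl)
  open SimpleRoots K
  module F = Field F
  open Semantics F c using (⟦_⟧ᵖ) renaming (⟦_⟧ˢ to ⟦_⟧ˢᶠ)
  open Semantics K (ι c) using (⟦_⟧ˢ)
  open Certificates K
    using (Polynomial; Certificate; Certified; []; _∷_; poly; derivative; horner; Bezout)
  open IntegerCoefficients commutativeRing using (⟦_⟧)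
  open import Relation.Binary.Reasoning.Setoid setoid

  γ : Carrier
  γ = ι c

  ι-≉0 : ∀ {b} → ¬ b F.≈ F.0# → ¬ ι b ≈ 0#
  ι-≉0 {b} b≉0 ιb≈0 = 1≉0 (begin
    1#                 ≈⟨ 1#-homo ⟨
    ι F.1#             ≈⟨ ⟦⟧-cong (F.sym (F.inverseʳ b b≉0)) ⟩
    ι (b F.* b F.⁻¹)   ≈⟨ *-homo b (b F.⁻¹) ⟩
    ι b * ι (b F.⁻¹)   ≈⟨ *-congʳ ιb≈0 ⟩
    0# * ι (b F.⁻¹)    ≈⟨ zeroˡ _ ⟩
    0#                 ∎)

  ι-scalar : ∀ s → ι ⟦ s ⟧ˢᶠ ≈ ⟦ s ⟧ˢ
  ι-scalar 𝐜       = refl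
  ι-scalar 𝟏       = 1#-homo
  ι-scalar (s ⊕ t) = trans (+-homo _ _) (+-cong (ι-scalar s) (ι-scalar t))
  ι-scalar (s ⊖ t) =
    trans (+-homo _ _) (+-cong (ι-scalar s) (trans (-‿homo _) (-‿cong (ι-scalar t))))
  ι-scalar (s ⊗ t) = trans (*-homo _ _) (*-cong (ι-scalar s) (ι-scalar t))

  γ-factor≉0 : NonvanishingFactors K γ
  γ-factor≉0 f = ι-≉0 (factor≉0 f) ∘ trans (ι-scalar (factor f))

  open Soundness K γ γ-factor≉0

  ev-poly : ∀ e α → ev ⟦ e ⟧ᵖ α ≈ ⟦ poly e ⟧ (γ ∷ α ∷ [])
  ev-poly 𝐗       α = ev-X α
  ev-poly (𝐂 s)   α = trans (ev-C ⟦ s ⟧ˢᶠ α) (trans (ι-scalar s) (sym (⟦scalar⟧ s (α ∷ []))))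
  ev-poly (e ⊞ f) α = trans (ev-+ₚ ⟦ e ⟧ᵖ ⟦ f ⟧ᵖ α) (+-cong (ev-poly e α) (ev-poly f α))
  ev-poly (e ⊟ f) α = trans (ev-+ₚ ⟦ e ⟧ᵖ (negₚ ⟦ f ⟧ᵖ) α)
    (+-cong (ev-poly e α) (trans (ev-negₚ ⟦ f ⟧ᵖ α) (-‿cong (ev-poly f α))))
  ev-poly (e ⊠ f) α = trans (ev-*ₚ ⟦ e ⟧ᵖ ⟦ f ⟧ᵖ α) (*-cong (ev-poly e α) (ev-poly f α))

  ev′-poly : ∀ e α → ev′ ⟦ e ⟧ᵖ α ≈ ⟦ derivative e ⟧ (γ ∷ α ∷ [])
  ev′-poly 𝐗       α = ev′-X α
  ev′-poly (𝐂 s)   α = ev′-C ⟦ s ⟧ˢᶠ α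
  ev′-poly (e ⊞ f) α = trans (ev′-+ₚ ⟦ e ⟧ᵖ ⟦ f ⟧ᵖ α) (+-cong (ev′-poly e α) (ev′-poly f α))
  ev′-poly (e ⊟ f) α = trans (ev′-+ₚ ⟦ e ⟧ᵖ (negₚ ⟦ f ⟧ᵖ) α)
    (+-cong (ev′-poly e α) (trans (ev′-negₚ ⟦ f ⟧ᵖ α) (-‿cong (ev′-poly f α))))
  ev′-poly (e ⊠ f) α = trans (ev′-*ₚ ⟦ e ⟧ᵖ ⟦ f ⟧ᵖ α)
    (+-cong (*-cong (ev′-poly e α) (ev-poly f α)) (*-cong (ev-poly e α) (ev′-poly f α)))

  ev-map : ∀ p α → Kᵉ.ev (List.map ι p) α ≈ ev p α × Kᵉ.ev′ (List.map ι p) α ≈ ev′ p α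
  ev-map []      α = refl , refl
  ev-map (b ∷ p) α = let v , v′ = ev-map p α in +-congˡ (*-congˡ v) , +-cong v (*-congˡ v′)

  coeff-top : ∀ {b} {A : Set b} (f : A → Carrier) xs y →
              coeff (List.map f (xs List.++ y ∷ [])) (List.length xs) ≡ f y
  coeff-top f []       y = ≡.refl
  coeff-top f (_ ∷ xs) y = coeff-top f xs y

  freshSimpleRoot : ∀ {e es} → Certificate e es →
              ∃ λ α → SimpleRoot (List.map ι ⟦ e ⟧ᵖ) α ×
                      All (NonRoot α) (List.map (List.map ι) (List.map ⟦_⟧ᵖ es))
  freshSimpleRoot {e} {es} cert = α , simpleRoot e-root e-simple , later-nonroots
    where
    open Certificate cert
    coefficients : List (Polynomial 1)
    coefficients = List⁺.toList lower List.++ top ∷ []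
    q : Pol
    q = List.map (λ t → ⟦ t ⟧ (γ ∷ [])) coefficients
    q-nonConstant : NonConstant q
    q-nonConstant = List⁺.length lower , s≤s z≤n ,
      NonVanishing-sound top≉0 ∘ trans (reflexive (≡.sym (coeff-top _ (List⁺.toList lower) top)))
    α : Carrier
    α = proj₁ (closed q q-nonConstant)
    ρ : Vec Carrier 2
    ρ = γ ∷ α ∷ []
    poly-root : ⟦ poly e ⟧ ρ ≈ 0#
    poly-root = begin
      ⟦ poly e ⟧ ρ                ≈⟨ normalise-sound (poly e) (horner coefficients) expansion ρ ⟩
      ⟦ horner coefficients ⟧ ρ   ≈⟨ ⟦horner⟧ coefficients α ⟩
      eval q α                    ≈⟨ proj₂ (closed q q-nonConstant) ⟩
      0#                          ∎
    e-root : Kᵉ.ev (List.map ι ⟦ e ⟧ᵖ) α ≈ 0#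
    e-root = trans (proj₁ (ev-map ⟦ e ⟧ᵖ α)) (trans (ev-poly e α) poly-root)
    e-simple : ¬ Kᵉ.ev′ (List.map ι ⟦ e ⟧ᵖ) α ≈ 0#
    e-simple = Bezout-sound simple α poly-root
             ∘ trans (sym (trans (proj₂ (ev-map ⟦ e ⟧ᵖ α)) (ev′-poly e α)))
    nonroot : ∀ {f} → Bezout (poly e) (poly f) → NonRoot α (List.map ι ⟦ f ⟧ᵖ)
    nonroot {f} b = Bezout-sound b α poly-root
                  ∘ trans (sym (trans (proj₁ (ev-map ⟦ f ⟧ᵖ α)) (ev-poly f α)))
    later-nonroots : All (NonRoot α) (List.map (List.map ι) (List.map ⟦_⟧ᵖ es))
    later-nonroots = All.map⁺ (All.map⁺ (All.map (λ {f} → nonroot {f}) coprime))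

  freshSimpleRoots : ∀ {es} → Certified es →
                     FreshSimpleRoots (List.map (List.map ι) (List.map ⟦_⟧ᵖ es))
  freshSimpleRoots []             = []
  freshSimpleRoots (cert ∷ certs) = freshSimpleRoot cert ∷ freshSimpleRoots certs

theorem3p1 :
    ∀ {a ℓ} (F : Field a ℓ) (c : Field.Carrier F) →
    let open Field F in
    CharNot2 →
    -- (1)
    ¬ (c ≈ - 1#) → ¬ (c ≈ 0#) → ¬ (c ≈ 1#) → ¬ (c ≈ 1# / 2#) → ¬ (c ≈ 2#) →
    -- (2)
    ¬ (c * c + c + 1# ≈ 0#) → ¬ (c * c + c - 1# ≈ 0#) →
    ¬ (c * c - c + 1# ≈ 0#) → ¬ (c * c - c - 1# ≈ 0#) →
    -- (3)
    ¬ (c * c - 3# * c + 1# ≈ 0#) →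
    -- (4)
    (CharNot3 → ¬ (c ≈ - (1# / 3#))) → (CharNot3 → ¬ (c ≈ - 3#)) →
    (CharNot3 → ¬ (c ≈ 2# / 3#)) → (CharNot3 → ¬ (c ≈ 3# / 2#)) →
    (CharNot3 → ¬ (c ≈ 1# / 3#)) → (CharNot3 → ¬ (c ≈ 3#)) →
    (CharNot3 → ¬ (c ≈ 4# / 3#)) → (CharNot3 → ¬ (c ≈ 3# / 4#)) →
    -- (5)
    ¬ (c * c - 3# * c + 3# ≈ 0#) → ¬ (3# * (c * c) - 3# * c + 1# ≈ 0#) →
    -- (6)
    ¬ (c * c * c + c * c - 1# ≈ 0#) → ¬ (c * c * c - c - 1# ≈ 0#) →
    -- (7)
    ¬ (c * c + 1# ≈ 0#) →
    -- (8)
    ¬ (c * c - 2# * c + 2# ≈ 0#) → ¬ (2# * (c * c) - 2# * c + 1# ≈ 0#) →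
    -- (9)
    ¬ (c * c * c - c * c + 2# * c - 1# ≈ 0#) →
    ¬ (c * c * c - 2# * (c * c) + c - 1# ≈ 0#) →
    -- (10)
    ¬ (c * c * c - 2# * (c * c) + 3# * c - 1# ≈ 0#) →
    ¬ (c * c * c - 3# * (c * c) + 2# * c - 1# ≈ 0#) →
    -- conclusion: square-free in K[x] for an algebraically closed
    -- extension K of F (embedding ι)
    (K : Field a ℓ) (ι : Carrier → Field.Carrier K) → IsFieldHom F K ι →
    AlgebraicallyClosed K →
    Poly.SquareFreeList K (map (map ι) (TheList.theList F c))
theorem3p1 F c 2≉0 c≉-1 c≉0 c≉1 c≉1/2 c≉2
           c²+c+1≉0 c²+c-1≉0 c²-c+1≉0 c²-c-1≉0 c²-3c+1≉0
           c≉-1/3 c≉-3 c≉2/3 c≉3/2 c≉1/3 c≉3 c≉4/3 c≉3/4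
           c²-3c+3≉0 3c²-3c+1≉0 c³+c²-1≉0 c³-c-1≉0 c²+1≉0 c²-2c+2≉0 2c²-2c+1≉0
           c³-c²+2c-1≉0 c³-2c²+c-1≉0 c³-2c²+3c-1≉0 c³-3c²+2c-1≉0 K ι ι-hom closed =
  ≡.subst (λ ps → Poly.SquareFreeList K (map (map ι) ps)) (polynomials-denote-theList F c)
    (SimpleRoots.squareFree K
      (RootsFromCertificates.freshSimpleRoots ι-hom c closed factor≉0 (Certificates.certified K)))
  where
  open Field F
  open ExcludedValues F c
  factor≉0 : NonvanishingFactors F c
  factor≉0 [2]           = 2≉0
  factor≉0 [c]           = c≉0
  factor≉0 [c+1]         = c+b≉0 c≉-1
  factor≉0 [c-1]         = c-b≉0 c≉1
  factor≉0 [2c-1]        = ac-b≉0 2≉0 c≉1/2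
  factor≉0 [c-2]         = c-b≉0 c≉2
  factor≉0 [c²+c+1]      = c²+c+1≉0
  factor≉0 [c²+c-1]      = c²+c-1≉0
  factor≉0 [c²-c+1]      = c²-c+1≉0
  factor≉0 [c²-c-1]      = c²-c-1≉0
  factor≉0 [c²-3c+1]     = c²-3c+1≉0
  factor≉0 [3c+1]        = 3c+1≉0 c≉-1/3
  factor≉0 [c+3]         = c+3≉0 c≉0 c≉-3
  factor≉0 [3c-2]        = 3c-2≉0 c≉2/3
  factor≉0 [2c-3]        = 2c-3≉0 2≉0 c≉0 c≉3/2
  factor≉0 [3c-1]        = 3c-1≉0 2≉0 c≉1/3
  factor≉0 [c-3]         = c-3≉0 c≉0 c≉3
  factor≉0 [3c-4]        = 3c-4≉0 2≉0 c≉4/3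
  factor≉0 [4c-3]        = 4c-3≉0 2≉0 c≉0 c≉3/4
  factor≉0 [c²-3c+3]     = c²-3c+3≉0
  factor≉0 [3c²-3c+1]    = 3c²-3c+1≉0
  factor≉0 [c³+c²-1]     = c³+c²-1≉0
  factor≉0 [c³-c-1]      = c³-c-1≉0
  factor≉0 [c²+1]        = c²+1≉0
  factor≉0 [c²-2c+2]     = c²-2c+2≉0
  factor≉0 [2c²-2c+1]    = 2c²-2c+1≉0
  factor≉0 [c³-c²+2c-1]  = c³-c²+2c-1≉0
  factor≉0 [c³-2c²+c-1]  = c³-2c²+c-1≉0
  factor≉0 [c³-2c²+3c-1] = c³-2c²+3c-1≉0
  factor≉0 [c³-3c²+2c-1] = c³-3c²+2c-1≉0
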